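{- Define $F$ on Schröder paths by $F_P=\mathrm{LLTe}_P(\mathbf{x};q+1)=\sum_{\theta\in\mathcal{O}(P)}q^{\mathrm{asc}(\theta)}\mathrm{e}_{\lambda(\theta)}(\mathbf{x})$. Then (i) $F_{\mathtt{n}\mathtt{d}^k\mathtt{e}}=\mathrm{e}_{k+1}$ for all integers $k\ge0$; (ii) $F_{PQ}=F_PF_Q$ for all Schröder paths $P,Q$; (iii) for all words $U,V\in\{\mathtt{n},\mathtt{d},\mathtt{e}\}^*$ such that $U\mathtt{d}V$ is a Schröder path, $F_{U\mathtt{n}\mathtt{e}V}-F_{U\mathtt{e}\mathtt{n}V}=qF_{U\mathtt{d}V}$.
   Context: Steps: $\mathtt{n}=(0,1)$, $\mathtt{e}=(1,0)$, $\mathtt{d}=(1,1)$. A Schröder path of size $n$ is a lattice path from $(0,0)$ to $(n,n)$ with steps in $\{\mathtt{n},\mathtt{e},\mathtt{d}\}$ such that every east and every diagonal step is preceded by strictly more north steps than east steps; paths are words in $\{\mathtt{n},\mathtt{d},\mathtt{e}\}^*$, $PQ$ is concatenation. $\mathrm{e}_\lambda=\prod_i\mathrm{e}_{\lambda_i}$ are elementary symmetric functions in $\mathbf{x}=(x_1,x_2,\dots)$. For $P$ of size $n$, $\Gamma_P$ is the graph on $[n]$ where, for $1\le a<b\le n$, $\{a,b\}$ is a non-strict edge if the unit square $[a-1,a]\times[b-1,b]$ lies in the region between $P$ and the line $y=x$, and a strict edge if $P$ has a diagonal step from $(a-1,b-1)$ to $(a,b)$. An orientation is a set $\theta$ containing,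 for each edge $\{u,v\}$, exactly one of $u\to v$, $v\to u$; $\mathcal{O}(P)$ is the set of orientations in which every strict edge $\{u,v\}$, $u<v$, is oriented $u\to v$. An edge $u\to v\in\theta$ is ascending if $u<v$ and $\{u,v\}$ non-strict; $\mathrm{asc}(\theta)$ counts them. $\mathrm{hrv}_\theta(u)$ is the maximal $v$ reachable from $u$ by a directed path (possibly empty) in $\theta$ using only strict and ascending edges; $\lambda(\theta)$ is the integer partition formed by the sizes of the classes of vertices with equal $\mathrm{hrv}_\theta$. -}

module Defs where

open import Data.Bool using (Bool; true; false; if_then_else_; _∧_; _∨_; not)
open import Data.Nat as ℕ using (ℕ; zero; suc; _<_; _≡ᵇ_; _<ᵇ_; _≤ᵇ_; _⊔_)
open import Data.Integer as ℤ using (ℤ; _*_; _+_; _^_)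
open import Data.List using (List; []; _∷_; _++_; map; concatMap; filter; length; foldr; upTo)
open import Data.Product using (_×_; _,_)
open import Relation.Binary.PropositionalEquality using (_≡_; _≢_)
open import Relation.Nullary.Decidable using (¬?)
open import Data.Nat.Properties using (_≟_)

data Step : Set where
  n e d : Step

countN countE countD : List Step → ℕ
countN []       = 0
countN (n ∷ w)  = suc (countN w)
countN (_ ∷ w)  = countN w
countE []       = 0
countE (e ∷ w)  = suc (countE w)
countE (_ ∷ w)  = countE w
countD []       = 0
countD (d ∷ w)  = suc (countD w)
countD (_ ∷ w)  = countD w

-- the endpoint of the path is (countE + countD , countN + countD);
-- the size of a Schröder path is its x-coordinate at the end
size : List Step → ℕ
size P = ℕ._+_ (countE P) (countD P)

record IsSchroder (P : List Step) : Set where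
  field
    ends-on-diagonal : ℕ._+_ (countN P) (countD P) ≡ size P
    prefix-condition : ∀ (U : List Step) (s : Step) (V : List Step) →
                       P ≡ U ++ (s ∷ V) → s ≢ n → countE U < countN U

choose : ℕ → List ℤ → List (List ℤ)
choose zero    _        = [] ∷ []
choose (suc k) []       = []
choose (suc k) (x ∷ xs) = map (x ∷_) (choose k xs) ++ choose (suc k) xs

sumℤ prodℤ : List ℤ → ℤ
sumℤ  = foldr _+_ (ℤ.+ 0)
prodℤ = foldr _*_ (ℤ.+ 1)

eSym : ℕ → List ℤ → ℤ
eSym k xs = sumℤ (map prodℤ (choose k xs))

eλ : List ℕ → List ℤ → ℤ
eλ la xs = prodℤ (map (λ k → eSym k xs) la)

-- columns of P: for the a-th non-north step (a = 1,2,…) its kind and the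
-- height at which it starts; the a-th such step goes from x = a-1 to x = a.
columns′ : ℕ → List Step → List (Step × ℕ)
columns′ y []      = []
columns′ y (n ∷ w) = columns′ (suc y) w
columns′ y (e ∷ w) = (e , y) ∷ columns′ y w
columns′ y (d ∷ w) = (d , y) ∷ columns′ (suc y) w

columns : List Step → List (Step × ℕ)
columns = columns′ 0

isD : Step → Bool
isD d = true
isD _ = false

record Edge : Set where
  constructor edge
  field
    lo hi  : ℕ
    strict : Bool

-- Edges {a,b} (1 ≤ a < b ≤ n) contributed by column a (starting height y):
--  * non-strict iff the unit square [a-1,a]×[b-1,b] lies between P and y=x,
--    i.e. a < b ≤ y (the path is at height ≥ y over the whole column);
--  * strict iff the a-th step is a diagonal step from (a-1,b-1) to (a,b).
edgesFrom : ℕ → ℕ → Step × ℕ → List Edge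
edgesFrom sz a (s , y) = concatMap f (map suc (upTo sz))
  where
  f : ℕ → List Edge
  f b = if a <ᵇ b then
          (if b ≤ᵇ y then edge a b false ∷ []
           else if isD s ∧ (b ≡ᵇ suc y) then edge a b true ∷ [] else [])
        else []

edgesCols : ℕ → ℕ → List (Step × ℕ) → List Edge
edgesCols sz a []       = []
edgesCols sz a (c ∷ cs) = edgesFrom sz a c ++ edgesCols sz (suc a) cs

edges : List Step → List Edge
edges P = edgesCols (size P) 1 (columns P)

record Arc : Set where
  constructor arc
  field
    src tgt : ℕ
    strict  : Bool

orientationsOf : List Edge → List (List Arc)
orientationsOf []                         = [] ∷ []
orientationsOf (edge a b true  ∷ es) = map (arc a b true ∷_) (orientationsOf es)
orientationsOf (edge a b false ∷ es) =
  map (arc a b false ∷_) (orientationsOf es) ++ map (arc b a false ∷_) (orientationsOf es)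

𝒪 : List Step → List (List Arc)
𝒪 P = orientationsOf (edges P)

isAscending : Arc → Bool
isAscending (arc u v s) = not s ∧ (u <ᵇ v)

asc : List Arc → ℕ
asc θ = length (filter (λ α → isAscending α Data.Bool.≟ true) θ)
  where import Data.Bool

usable : Arc → Bool
usable α = Arc.strict α ∨ isAscending α

reach : List Arc → ℕ → ℕ → List ℕ
reach θ zero     u = u ∷ []
reach θ (suc f) u =
  u ∷ concatMap (λ α → if (Arc.src α ≡ᵇ u) ∧ usable α then reach θ f (Arc.tgt α) else []) θ

-- hrv_θ(u) for a graph on [sz]: every usable arc goes from a smaller to a
-- larger vertex, so directed paths have length < sz and fuel sz suffices
hrv : ℕ → List Arc → ℕ → ℕ
hrv sz θ u = foldr _⊔_ 0 (reach θ sz u)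

vertices : ℕ → List ℕ
vertices sz = map suc (upTo sz)

-- λ(θ): the sizes of the (nonempty) classes of vertices with equal hrv_θ
-- (listed by the common hrv-value h ∈ [sz]; order of parts is irrelevant for e_λ)
lam : ℕ → List Arc → List ℕ
lam sz θ = filter (λ k → ¬? (k ≟ 0))
  (map (λ h → length (filter (λ u → hrv sz θ u ≟ h) (vertices sz))) (vertices sz))

-- F_P = Σ_{θ ∈ 𝒪(P)} q^{asc θ} e_{λ(θ)}(x), evaluated at q and x = (x_1,…,x_N,0,0,…)

F : List Step → ℤ → List ℤ → ℤ
F P q xs = sumℤ (map (λ θ → (q ^ asc θ) * eλ (lam (size P) θ) xs) (𝒪 P))

{-# OPTIONS --safe #-}
-- Γ_P can be read off P column by column: column a, starting at height y, contributes the
-- non-strict edges {a,b} with a < b ≤ y and, if its step is diagonal, the strict edge {a,y+1}.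
-- (i)   For n dᵏ e this is the path 1 – 2 – ⋯ – k+1 of strict edges: it has one orientation, with
--       no ascent, in which every vertex reaches k+1, so λ = (k+1).
-- (ii)  As P returns to the diagonal, Γ of PQ is Γ_P side by side with Γ_Q shifted by |P|.
--       Orientations split into pairs, asc adds up, and no arc joins the two blocks, so λ is the
--       concatenation of the two partitions and the weights q^asc e_λ multiply.
-- (iii) If the d step of UdV lies in column a and ends at height b, the graphs of UneV, UenV and
--       UdV agree except for the edge {a,b}, which is non-strict, absent and strict respectively.
--       Orienting it b → a is invisible to asc and hrv, which gives F of UenV; orienting it a → b
--       adds one ascent and acts on hrv like the strict edge, which gives q F of UdV.
module Submission where

open import Defs
open import Data.Nat using (ℕ; suc)
open import Data.Integer using (ℤ; _*_; _-_)
open import Data.List using (List; []; _∷_; _++_; replicate)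
open import Data.Product using (_×_)
open import Relation.Binary.PropositionalEquality using (_≡_)

open import Data.Bool using (true; false; T; if_then_else_; _∧_; not)
open import Data.Bool.Properties using (T-≡; if-eta; if-float)
open import Data.Nat using (zero; _+_; _∸_; _≤_; _<_; _≡ᵇ_; _<ᵇ_; _≤ᵇ_; _⊔_; z≤n; s≤s)
open import Data.Integer as ℤ using (_^_)
import Data.Integer.Properties as ℤ
open import Algebra.Properties.CommutativeSemigroup ℤ.+-commutativeSemigroup
  using () renaming (interchange to +-interchange)
open import Algebra.Properties.CommutativeSemigroup ℤ.*-commutativeSemigroup
  using () renaming (interchange to *-interchange)
open import Algebra.Properties.AbelianGroup ℤ.+-0-abelianGroup
  using () renaming (//-rightDividesʳ to +-minus-cancelʳ)
open import Data.List using (map; concat; concatMap; filter; length; foldr; upTo)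
open import Data.List.Properties
  using (map-++; map-∘; map-cong; map-cong-local; length-++; length-map; length-upTo; upTo-∷ʳ;
         ++-assoc; ++-identityʳ; concatMap-++; concatMap-cong; concatMap-map; map-concatMap; foldr-preservesᵇ;
         filter-++; filter-none; filter-all; filter-≐)
open import Data.List.Membership.Propositional using (_∈_)
open import Data.List.Relation.Unary.All as All using (All; []; _∷_)
open import Data.List.Relation.Unary.All.Properties using (++⁺; map⁺; concat⁺)
open import Data.List.Relation.Unary.Any using (here; there)
open import Data.Nat.Properties
open import Data.Product using (_,_; proj₁; proj₂)
open import Data.Sum using (inj₁; inj₂)
open import Data.Empty using (⊥-elim)
open import Function using (_∘_; _⇔_; Equivalence; mk⇔)
open import Relation.Binary.PropositionalEquality
  using (refl; sym; trans; cong; cong₂; subst; _≢_; module ≡-Reasoning)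
open import Relation.Nullary using (¬_; yes; no; contradiction)
open import Relation.Nullary.Decidable using (¬?)
open import Relation.Unary using (Decidable)

T⇒≡true : ∀ {b} → T b → b ≡ true
T⇒≡true = Equivalence.to T-≡

¬T⇒≡false : ∀ {b} → ¬ T b → b ≡ false
¬T⇒≡false {false} _  = refl
¬T⇒≡false {true}  ¬t = contradiction _ ¬t

<ᵇ-true : ∀ {i j} → i < j → (i <ᵇ j) ≡ true
<ᵇ-true = T⇒≡true ∘ <⇒<ᵇ

<ᵇ-false : ∀ {i j} → j ≤ i → (i <ᵇ j) ≡ false
<ᵇ-false j≤i = ¬T⇒≡false (≤⇒≯ j≤i ∘ <ᵇ⇒< _ _)

<ᵇ≡true⇒< : ∀ {i j} → (i <ᵇ j) ≡ true → i < j
<ᵇ≡true⇒< = <ᵇ⇒< _ _ ∘ Equivalence.from T-≡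

≡ᵇ≡true⇒≡ : ∀ {i j} → (i ≡ᵇ j) ≡ true → i ≡ j
≡ᵇ≡true⇒≡ = ≡ᵇ⇒≡ _ _ ∘ Equivalence.from T-≡

≤ᵇ-true : ∀ {i j} → i ≤ j → (i ≤ᵇ j) ≡ true
≤ᵇ-true = T⇒≡true ∘ ≤⇒≤ᵇ

≤ᵇ-false : ∀ {i j} → j < i → (i ≤ᵇ j) ≡ false
≤ᵇ-false j<i = ¬T⇒≡false (<⇒≱ j<i ∘ ≤ᵇ⇒≤ _ _)

≡ᵇ-refl : ∀ i → (i ≡ᵇ i) ≡ true
≡ᵇ-refl i = T⇒≡true (≡⇒≡ᵇ i i refl)

≡ᵇ-false : ∀ {i j} → i ≢ j → (i ≡ᵇ j) ≡ false
≡ᵇ-false i≢j = ¬T⇒≡false (i≢j ∘ ≡ᵇ⇒≡ _ _)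

<ᵇ-+ : ∀ m i j → (m + i <ᵇ m + j) ≡ (i <ᵇ j)
<ᵇ-+ zero    i j = refl
<ᵇ-+ (suc m) i j = <ᵇ-+ m i j

≡ᵇ-+ : ∀ m i j → (m + i ≡ᵇ m + j) ≡ (i ≡ᵇ j)
≡ᵇ-+ zero    i j = refl
≡ᵇ-+ (suc m) i j = ≡ᵇ-+ m i j

concatMap-nil : ∀ {A B : Set} {f : A → List B} {xs} →
                All (λ x → f x ≡ []) xs → concatMap f xs ≡ []
concatMap-nil []          = refl
concatMap-nil (fx≡[] ∷ p) rewrite fx≡[] = concatMap-nil p

concatMap-cong-local : ∀ {A B : Set} {f g : A → List B} {xs} →
                       All (λ x → f x ≡ g x) xs → concatMap f xs ≡ concatMap g xs
concatMap-cong-local = cong concat ∘ map-cong-local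

filter-cong-local : ∀ {A : Set} {P Q : A → Set} (P? : Decidable P) (Q? : Decidable Q) {xs} →
                    All (λ x → P x ⇔ Q x) xs → filter P? xs ≡ filter Q? xs
filter-cong-local P? Q? []                    = refl
filter-cong-local P? Q? {x ∷ xs} (P⇔Q ∷ rest) with P? x | Q? x
... | yes _ | yes _ = cong (x ∷_) (filter-cong-local P? Q? rest)
... | no _  | no _  = filter-cong-local P? Q? rest
... | yes p | no ¬q = contradiction (Equivalence.to P⇔Q p) ¬q
... | no ¬p | yes q = contradiction (Equivalence.from P⇔Q q) ¬p

length-filter-map : ∀ {A B : Set} {P : B → Set} (P? : Decidable P) (f : A → B) xs →
                    length (filter P? (map f xs)) ≡ length (filter (P? ∘ f) xs)
length-filter-map P? f []       = refl
length-filter-map P? f (x ∷ xs) with P? (f x)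
... | yes _ = cong suc (length-filter-map P? f xs)
... | no _  = length-filter-map P? f xs

IsVertex : ℕ → ℕ → Set
IsVertex k u = 1 ≤ u × u ≤ k

vertices-suc : ∀ k → vertices (suc k) ≡ vertices k ++ suc k ∷ []
vertices-suc k = trans (cong (map suc) (sym (upTo-∷ʳ k))) (map-++ suc (upTo k) (k ∷ []))

vertices-+ : ∀ i j → vertices (i + j) ≡ vertices i ++ map (i +_) (vertices j)
vertices-+ i zero    = trans (cong vertices (+-identityʳ i)) (sym (++-identityʳ (vertices i)))
vertices-+ i (suc j) = begin
  vertices (i + suc j)
    ≡⟨ cong vertices (+-suc i j) ⟩
  vertices (suc (i + j))
    ≡⟨ vertices-suc (i + j) ⟩
  vertices (i + j) ++ suc (i + j) ∷ []
    ≡⟨ cong (_++ suc (i + j) ∷ []) (vertices-+ i j) ⟩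
  (vertices i ++ map (i +_) (vertices j)) ++ suc (i + j) ∷ []
    ≡⟨ ++-assoc (vertices i) _ _ ⟩
  vertices i ++ (map (i +_) (vertices j) ++ suc (i + j) ∷ [])
    ≡⟨ cong (vertices i ++_) tail ⟩
  vertices i ++ map (i +_) (vertices (suc j)) ∎
  where
  open ≡-Reasoning
  tail : map (i +_) (vertices j) ++ suc (i + j) ∷ [] ≡ map (i +_) (vertices (suc j))
  tail = begin
    map (i +_) (vertices j) ++ suc (i + j) ∷ []
      ≡⟨ cong (λ x → map (i +_) (vertices j) ++ x ∷ []) (sym (+-suc i j)) ⟩
    map (i +_) (vertices j) ++ i + suc j ∷ []
      ≡⟨ sym (map-++ (i +_) (vertices j) _) ⟩
    map (i +_) (vertices j ++ suc j ∷ [])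
      ≡⟨ cong (map (i +_)) (sym (vertices-suc j)) ⟩
    map (i +_) (vertices (suc j)) ∎

vertices-IsVertex : ∀ k → All (IsVertex k) (vertices k)
vertices-IsVertex zero    = []
vertices-IsVertex (suc k) = subst (All (IsVertex (suc k))) (sym (vertices-suc k))
  (++⁺ (All.map (λ (1≤u , u≤k) → 1≤u , m≤n⇒m≤1+n u≤k) (vertices-IsVertex k))
       ((s≤s z≤n , ≤-refl) ∷ []))

maxℕ : List ℕ → ℕ
maxℕ = foldr _⊔_ 0

maxℕ-++ : ∀ xs ys → maxℕ (xs ++ ys) ≡ maxℕ xs ⊔ maxℕ ys
maxℕ-++ []       ys = refl
maxℕ-++ (x ∷ xs) ys = trans (cong (x ⊔_) (maxℕ-++ xs ys)) (sym (⊔-assoc x (maxℕ xs) (maxℕ ys)))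

maxℕ-≤ : ∀ {B xs} → All (_≤ B) xs → maxℕ xs ≤ B
maxℕ-≤ = foldr-preservesᵇ ⊔-lub z≤n

maxℕ-concatMap : ∀ {A : Set} (g : A → List ℕ) {x xs} → x ∈ xs →
                 maxℕ (g x) ≤ maxℕ (concatMap g xs)
maxℕ-concatMap g {xs = y ∷ ys} (here refl) =
  subst (maxℕ (g y) ≤_) (sym (maxℕ-++ (g y) _)) (m≤m⊔n _ _)
maxℕ-concatMap g {x} {y ∷ ys} (there x∈ys) =
  subst (maxℕ (g x) ≤_) (sym (maxℕ-++ (g y) _)) (≤-trans (maxℕ-concatMap g x∈ys) (m≤n⊔m _ _))

maxℕ-shift : ∀ m x xs → maxℕ (map (m +_) (x ∷ xs)) ≡ m + maxℕ (x ∷ xs)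
maxℕ-shift m x []       = trans (⊔-identityʳ (m + x)) (cong (m +_) (sym (⊔-identityʳ x)))
maxℕ-shift m x (y ∷ xs) = trans (cong ((m + x) ⊔_) (maxℕ-shift m y xs)) (sym (+-distribˡ-⊔ m x _))

-- Columns of a path

endHeight : ℕ → List Step → ℕ
endHeight y []      = y
endHeight y (n ∷ w) = endHeight (suc y) w
endHeight y (e ∷ w) = endHeight y w
endHeight y (d ∷ w) = endHeight (suc y) w

endHeight≡ : ∀ y w → endHeight y w ≡ y + (countN w + countD w)
endHeight≡ y []      = sym (+-identityʳ y)
endHeight≡ y (n ∷ w) = trans (endHeight≡ (suc y) w) (sym (+-suc y _))
endHeight≡ y (e ∷ w) = endHeight≡ y w
endHeight≡ y (d ∷ w) = begin
  endHeight (suc y) w                   ≡⟨ endHeight≡ (suc y) w ⟩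
  suc y + (countN w + countD w)         ≡⟨ sym (+-suc y _) ⟩
  y + suc (countN w + countD w)         ≡⟨ cong (y +_) (sym (+-suc (countN w) (countD w))) ⟩
  y + (countN w + suc (countD w))       ∎
  where open ≡-Reasoning

endHeight-≥ : ∀ y w → y ≤ endHeight y w
endHeight-≥ y w = subst (y ≤_) (sym (endHeight≡ y w)) (m≤m+n y _)

endHeight-shift : ∀ m w → endHeight m w ≡ m + endHeight 0 w
endHeight-shift m w = trans (endHeight≡ m w) (cong (m +_) (sym (endHeight≡ 0 w)))

endHeight-++ : ∀ y U W → endHeight y (U ++ W) ≡ endHeight (endHeight y U) W
endHeight-++ y []      W = refl
endHeight-++ y (n ∷ U) W = endHeight-++ (suc y) U W
endHeight-++ y (e ∷ U) W = endHeight-++ y U W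
endHeight-++ y (d ∷ U) W = endHeight-++ (suc y) U W

columns′-++ : ∀ y U W → columns′ y (U ++ W) ≡ columns′ y U ++ columns′ (endHeight y U) W
columns′-++ y []      W = refl
columns′-++ y (n ∷ U) W = columns′-++ (suc y) U W
columns′-++ y (e ∷ U) W = cong ((e , y) ∷_) (columns′-++ y U W)
columns′-++ y (d ∷ U) W = cong ((d , y) ∷_) (columns′-++ (suc y) U W)

length-columns′ : ∀ y w → length (columns′ y w) ≡ size w
length-columns′ y []      = refl
length-columns′ y (n ∷ w) = length-columns′ (suc y) w
length-columns′ y (e ∷ w) = cong suc (length-columns′ y w)
length-columns′ y (d ∷ w) =
  trans (cong suc (length-columns′ (suc y) w)) (sym (+-suc (countE w) (countD w)))

size-++ : ∀ U W → size (U ++ W) ≡ size U + size W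
size-++ U W = begin
  size (U ++ W)
    ≡⟨ sym (length-columns′ 0 (U ++ W)) ⟩
  length (columns′ 0 (U ++ W))
    ≡⟨ cong length (columns′-++ 0 U W) ⟩
  length (columns U ++ columns′ (endHeight 0 U) W)
    ≡⟨ length-++ (columns U) ⟩
  length (columns U) + length (columns′ (endHeight 0 U) W)
    ≡⟨ cong₂ _+_ (length-columns′ 0 U) (length-columns′ _ W) ⟩
  size U + size W ∎
  where open ≡-Reasoning

size-d∷ : ∀ w → size (d ∷ w) ≡ suc (size w)
size-d∷ w = +-suc (countE w) (countD w)

shiftColumn : ℕ → Step × ℕ → Step × ℕ
shiftColumn m (s , y) = s , m + y

columns′-+ : ∀ m y w → columns′ (m + y) w ≡ map (shiftColumn m) (columns′ y w)
columns′-+ m y []      = refl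
columns′-+ m y (n ∷ w) =
  trans (cong (λ z → columns′ z w) (sym (+-suc m y))) (columns′-+ m (suc y) w)
columns′-+ m y (e ∷ w) = cong ((e , m + y) ∷_) (columns′-+ m y w)
columns′-+ m y (d ∷ w) =
  cong ((d , m + y) ∷_) (trans (cong (λ z → columns′ z w) (sym (+-suc m y))) (columns′-+ m (suc y) w))

columnTop : Step × ℕ → ℕ
columnTop (d , y) = suc y
columnTop (_ , y) = y

columns′-below : ∀ y w → All (λ c → columnTop c ≤ endHeight y w) (columns′ y w)
columns′-below y []      = []
columns′-below y (n ∷ w) = columns′-below (suc y) w
columns′-below y (e ∷ w) = endHeight-≥ y w ∷ columns′-below y w
columns′-below y (d ∷ w) = endHeight-≥ (suc y) w ∷ columns′-below (suc y) w

EndsOnDiagonal : List Step → Set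
EndsOnDiagonal P = endHeight 0 P ≡ size P

IsSchroder⇒EndsOnDiagonal : ∀ {P} → IsSchroder P → EndsOnDiagonal P
IsSchroder⇒EndsOnDiagonal {P} isS = trans (endHeight≡ 0 P) (IsSchroder.ends-on-diagonal isS)

step-above-diagonal : ∀ {U s V} → IsSchroder (U ++ s ∷ V) → s ≢ n → size U < endHeight 0 U
step-above-diagonal {U} {s} {V} isS s≢n = subst (size U <_) (sym (endHeight≡ 0 U))
  (+-monoˡ-< (countD U) (IsSchroder.prefix-condition isS U s V refl s≢n))

-- The edges of Γ_P

-- the local function of 'edgesFrom', so that
-- 'edgesFrom sz a (s , y)' is 'concatMap (candidateEdge a s y) (vertices sz)' by definition
candidateEdge : ℕ → Step → ℕ → ℕ → List Edge
candidateEdge a s y b =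
  if a <ᵇ b then
    (if b ≤ᵇ y then edge a b false ∷ []
     else if isD s ∧ (b ≡ᵇ suc y) then edge a b true ∷ [] else [])
  else []

nonStrictEdge : ℕ → ℕ → List Edge
nonStrictEdge a b = if a <ᵇ b then edge a b false ∷ [] else []

lowerEdges : ℕ → ℕ → List Edge
lowerEdges a y = concatMap (nonStrictEdge a) (vertices y)

diagonalEdge : ℕ → Step → ℕ → List Edge
diagonalEdge a d y = if a <ᵇ suc y then edge a (suc y) true ∷ [] else []
diagonalEdge a _ y = []

edgesOfColumn : ℕ → Step × ℕ → List Edge
edgesOfColumn a (s , y) = lowerEdges a y ++ diagonalEdge a s y

edgesOfColumns : ℕ → List (Step × ℕ) → List Edge
edgesOfColumns a []       = []
edgesOfColumns a (c ∷ cs) = edgesOfColumn a c ++ edgesOfColumns (suc a) cs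

candidateEdge-below : ∀ a s {y b} → b ≤ y → candidateEdge a s y b ≡ nonStrictEdge a b
candidateEdge-below a s b≤y rewrite ≤ᵇ-true b≤y = refl

candidateEdge-above : ∀ a s y {b} → columnTop (s , y) < b → candidateEdge a s y b ≡ []
candidateEdge-above a n y {b} y<b rewrite ≤ᵇ-false y<b = if-eta (a <ᵇ b)
candidateEdge-above a e y {b} y<b rewrite ≤ᵇ-false y<b = if-eta (a <ᵇ b)
candidateEdge-above a d y {b} 1+y<b
  rewrite ≤ᵇ-false (<-trans (n<1+n y) 1+y<b) | ≡ᵇ-false (>⇒≢ 1+y<b) = if-eta (a <ᵇ b)

candidateEdges-lower : ∀ a s y → concatMap (candidateEdge a s y) (vertices y) ≡ lowerEdges a y
candidateEdges-lower a s y =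
  concatMap-cong-local (All.map (λ (_ , b≤y) → candidateEdge-below a s b≤y) (vertices-IsVertex y))

candidateEdges-upToTop : ∀ a s y →
  concatMap (candidateEdge a s y) (vertices (columnTop (s , y))) ≡ edgesOfColumn a (s , y)
candidateEdges-upToTop a n y = trans (candidateEdges-lower a n y) (sym (++-identityʳ _))
candidateEdges-upToTop a e y = trans (candidateEdges-lower a e y) (sym (++-identityʳ _))
candidateEdges-upToTop a d y = begin
  concatMap cand (vertices (suc y))
    ≡⟨ cong (concatMap cand) (vertices-suc y) ⟩
  concatMap cand (vertices y ++ suc y ∷ [])
    ≡⟨ concatMap-++ cand (vertices y) _ ⟩
  concatMap cand (vertices y) ++ (cand (suc y) ++ [])
    ≡⟨ cong₂ _++_ (candidateEdges-lower a d y) (trans (++-identityʳ _) top) ⟩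
  lowerEdges a y ++ diagonalEdge a d y ∎
  where
  open ≡-Reasoning
  cand = candidateEdge a d y
  top : cand (suc y) ≡ diagonalEdge a d y
  top rewrite ≤ᵇ-false (n<1+n y) | ≡ᵇ-refl y = refl

edgesFrom≡edgesOfColumn : ∀ {sz} a c → columnTop c ≤ sz → edgesFrom sz a c ≡ edgesOfColumn a c
edgesFrom≡edgesOfColumn {sz} a (s , y) top≤sz = begin
  edgesFrom sz a (s , y)
    ≡⟨ cong (concatMap cand ∘ vertices) (sym (m+[n∸m]≡n top≤sz)) ⟩
  concatMap cand (vertices (top + j))
    ≡⟨ cong (concatMap cand) (vertices-+ top j) ⟩
  concatMap cand (vertices top ++ map (top +_) (vertices j))
    ≡⟨ concatMap-++ cand (vertices top) _ ⟩
  concatMap cand (vertices top) ++ concatMap cand (map (top +_) (vertices j))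
    ≡⟨ cong₂ _++_ (candidateEdges-upToTop a s y)
                  (concatMap-nil (map⁺ (All.map above (vertices-IsVertex j)))) ⟩
  edgesOfColumn a (s , y) ++ []
    ≡⟨ ++-identityʳ _ ⟩
  edgesOfColumn a (s , y) ∎
  where
  open ≡-Reasoning
  cand = candidateEdge a s y
  top = columnTop (s , y)
  j = sz ∸ top
  above : ∀ {b} → IsVertex j b → cand (top + b) ≡ []
  above (1≤b , _) = candidateEdge-above a s y (m<m+n top 1≤b)

edgesCols≡edgesOfColumns : ∀ {sz} a C → All (λ c → columnTop c ≤ sz) C →
                           edgesCols sz a C ≡ edgesOfColumns a C
edgesCols≡edgesOfColumns a []      []       = refl
edgesCols≡edgesOfColumns a (c ∷ C) (t ∷ ts) =
  cong₂ _++_ (edgesFrom≡edgesOfColumn a c t) (edgesCols≡edgesOfColumns (suc a) C ts)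

edges≡edgesOfColumns : ∀ P → EndsOnDiagonal P → edges P ≡ edgesOfColumns 1 (columns P)
edges≡edgesOfColumns P diag = edgesCols≡edgesOfColumns 1 (columns P)
  (subst (λ B → All (λ c → columnTop c ≤ B) (columns P)) diag (columns′-below 0 P))

edgesOfColumns-++ : ∀ a C C′ →
  edgesOfColumns a (C ++ C′) ≡ edgesOfColumns a C ++ edgesOfColumns (a + length C) C′
edgesOfColumns-++ a []      C′ = cong (λ i → edgesOfColumns i C′) (sym (+-identityʳ a))
edgesOfColumns-++ a (c ∷ C) C′ = begin
  edgesOfColumn a c ++ edgesOfColumns (suc a) (C ++ C′)
    ≡⟨ cong (edgesOfColumn a c ++_) (edgesOfColumns-++ (suc a) C C′) ⟩
  edgesOfColumn a c ++ (edgesOfColumns (suc a) C ++ edgesOfColumns (suc a + length C) C′)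
    ≡⟨ sym (++-assoc (edgesOfColumn a c) _ _) ⟩
  edgesOfColumns a (c ∷ C) ++ edgesOfColumns (suc a + length C) C′
    ≡⟨ cong (λ i → edgesOfColumns a (c ∷ C) ++ edgesOfColumns i C′) (sym (+-suc a (length C))) ⟩
  edgesOfColumns a (c ∷ C) ++ edgesOfColumns (a + length (c ∷ C)) C′ ∎
  where open ≡-Reasoning

nonStrictEdge-≤ : ∀ {a b} → b ≤ a → nonStrictEdge a b ≡ []
nonStrictEdge-≤ b≤a rewrite <ᵇ-false b≤a = refl

lowerEdges-≤ : ∀ {a y} → y ≤ a → lowerEdges a y ≡ []
lowerEdges-≤ y≤a =
  concatMap-nil (All.map (λ (_ , b≤y) → nonStrictEdge-≤ (≤-trans b≤y y≤a)) (vertices-IsVertex _))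

lowerEdges-suc : ∀ {a y} → a ≤ y → lowerEdges a (suc y) ≡ lowerEdges a y ++ edge a (suc y) false ∷ []
lowerEdges-suc {a} {y} a≤y = begin
  concatMap (nonStrictEdge a) (vertices (suc y))
    ≡⟨ cong (concatMap _) (vertices-suc y) ⟩
  concatMap (nonStrictEdge a) (vertices y ++ suc y ∷ [])
    ≡⟨ concatMap-++ (nonStrictEdge a) (vertices y) _ ⟩
  lowerEdges a y ++ (nonStrictEdge a (suc y) ++ [])
    ≡⟨ cong (lowerEdges a y ++_) (trans (++-identityʳ _) last) ⟩
  lowerEdges a y ++ edge a (suc y) false ∷ [] ∎
  where
  open ≡-Reasoning
  last : nonStrictEdge a (suc y) ≡ edge a (suc y) false ∷ []
  last rewrite <ᵇ-true (s≤s a≤y) = refl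

edgesOfColumn-e : ∀ a y → edgesOfColumn a (e , y) ≡ lowerEdges a y
edgesOfColumn-e a y = ++-identityʳ _

edgesOfColumn-d : ∀ {a y} → a ≤ y → edgesOfColumn a (d , y) ≡ lowerEdges a y ++ edge a (suc y) true ∷ []
edgesOfColumn-d a≤y rewrite <ᵇ-true (s≤s a≤y) = refl

shiftEdge : ℕ → Edge → Edge
shiftEdge m (edge x y s) = edge (m + x) (m + y) s

nonStrictEdge-+ : ∀ m a b → nonStrictEdge (m + a) (m + b) ≡ map (shiftEdge m) (nonStrictEdge a b)
nonStrictEdge-+ m a b =
  trans (cong (λ c → if c then edge (m + a) (m + b) false ∷ [] else []) (<ᵇ-+ m a b))
        (sym (if-float (map (shiftEdge m)) (a <ᵇ b)))

lowerEdges-+ : ∀ m a y → lowerEdges (m + a) (m + y) ≡ map (shiftEdge m) (lowerEdges a y)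
lowerEdges-+ m a y = begin
  concatMap f (vertices (m + y))
    ≡⟨ cong (concatMap f) (vertices-+ m y) ⟩
  concatMap f (vertices m ++ map (m +_) (vertices y))
    ≡⟨ concatMap-++ f (vertices m) _ ⟩
  concatMap f (vertices m) ++ concatMap f (map (m +_) (vertices y))
    ≡⟨ cong₂ _++_ low (concatMap-map f (m +_) (vertices y)) ⟩
  concatMap (f ∘ (m +_)) (vertices y)
    ≡⟨ concatMap-cong (nonStrictEdge-+ m a) (vertices y) ⟩
  concatMap (map (shiftEdge m) ∘ nonStrictEdge a) (vertices y)
    ≡⟨ sym (map-concatMap (shiftEdge m) (nonStrictEdge a) (vertices y)) ⟩
  map (shiftEdge m) (lowerEdges a y) ∎
  where
  open ≡-Reasoning
  f = nonStrictEdge (m + a)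
  low : concatMap f (vertices m) ≡ []
  low = concatMap-nil
    (All.map (λ (_ , b≤m) → nonStrictEdge-≤ (≤-trans b≤m (m≤m+n m a))) (vertices-IsVertex m))

diagonalEdge-+ : ∀ m a s y → diagonalEdge (m + a) s (m + y) ≡ map (shiftEdge m) (diagonalEdge a s y)
diagonalEdge-+ m a n y = refl
diagonalEdge-+ m a e y = refl
diagonalEdge-+ m a d y = begin
  (if m + a <ᵇ suc (m + y) then edge (m + a) (suc (m + y)) true ∷ [] else [])
    ≡⟨ cong (λ t → if m + a <ᵇ t then edge (m + a) t true ∷ [] else []) (sym (+-suc m y)) ⟩
  (if m + a <ᵇ m + suc y then edge (m + a) (m + suc y) true ∷ [] else [])
    ≡⟨ cong (λ c → if c then edge (m + a) (m + suc y) true ∷ [] else []) (<ᵇ-+ m a (suc y)) ⟩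
  (if a <ᵇ suc y then edge (m + a) (m + suc y) true ∷ [] else [])
    ≡⟨ sym (if-float (map (shiftEdge m)) (a <ᵇ suc y)) ⟩
  map (shiftEdge m) (diagonalEdge a d y) ∎
  where open ≡-Reasoning

edgesOfColumns-+ : ∀ m a C →
  edgesOfColumns (m + a) (map (shiftColumn m) C) ≡ map (shiftEdge m) (edgesOfColumns a C)
edgesOfColumns-+ m a []            = refl
edgesOfColumns-+ m a ((s , y) ∷ C) = begin
  (lowerEdges (m + a) (m + y) ++ diagonalEdge (m + a) s (m + y))
    ++ edgesOfColumns (suc (m + a)) (map (shiftColumn m) C)
    ≡⟨ cong₂ _++_ (cong₂ _++_ (lowerEdges-+ m a y) (diagonalEdge-+ m a s y))
                  (trans (cong (λ i → edgesOfColumns i (map (shiftColumn m) C)) (sym (+-suc m a)))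
                         (edgesOfColumns-+ m (suc a) C)) ⟩
  (map (shiftEdge m) (lowerEdges a y) ++ map (shiftEdge m) (diagonalEdge a s y))
    ++ map (shiftEdge m) (edgesOfColumns (suc a) C)
    ≡⟨ cong (_++ _) (sym (map-++ (shiftEdge m) (lowerEdges a y) _)) ⟩
  map (shiftEdge m) (edgesOfColumn a (s , y)) ++ map (shiftEdge m) (edgesOfColumns (suc a) C)
    ≡⟨ sym (map-++ (shiftEdge m) (edgesOfColumn a (s , y)) _) ⟩
  map (shiftEdge m) (edgesOfColumns a ((s , y) ∷ C)) ∎
  where open ≡-Reasoning

Upward : ℕ → ℕ × ℕ → Set
Upward B (x , y) = 1 ≤ x × x < y × y ≤ B

endpoints : Edge → ℕ × ℕ
endpoints (edge x y _) = x , y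

candidateEdge-upward : ∀ {sz} a s y b → 1 ≤ a → IsVertex sz b →
                       All (Upward sz ∘ endpoints) (candidateEdge a s y b)
candidateEdge-upward a s y b 1≤a (_ , b≤sz) with a <ᵇ b in a<ᵇb
... | false = []
... | true with b ≤ᵇ y
...   | true = (1≤a , <ᵇ≡true⇒< a<ᵇb , b≤sz) ∷ []
...   | false with isD s ∧ (b ≡ᵇ suc y)
...     | true  = (1≤a , <ᵇ≡true⇒< a<ᵇb , b≤sz) ∷ []
...     | false = []

edgesCols-upward : ∀ sz a C → 1 ≤ a → All (Upward sz ∘ endpoints) (edgesCols sz a C)
edgesCols-upward sz a []            _   = []
edgesCols-upward sz a ((s , y) ∷ C) 1≤a =
  ++⁺ (concat⁺ (map⁺ (All.map (candidateEdge-upward a s y _ 1≤a) (vertices-IsVertex sz))))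
      (edgesCols-upward sz (suc a) C (m≤n⇒m≤1+n 1≤a))

edges-upward : ∀ P → All (Upward (size P) ∘ endpoints) (edges P)
edges-upward P = edgesCols-upward (size P) 1 (columns P) ≤-refl

EndsOnDiagonal-++ : ∀ P Q → EndsOnDiagonal P → EndsOnDiagonal Q → EndsOnDiagonal (P ++ Q)
EndsOnDiagonal-++ P Q diagP diagQ = begin
  endHeight 0 (P ++ Q)         ≡⟨ endHeight-++ 0 P Q ⟩
  endHeight (endHeight 0 P) Q  ≡⟨ cong (λ h → endHeight h Q) diagP ⟩
  endHeight (size P) Q         ≡⟨ endHeight-shift (size P) Q ⟩
  size P + endHeight 0 Q       ≡⟨ cong (size P +_) diagQ ⟩
  size P + size Q              ≡⟨ sym (size-++ P Q) ⟩
  size (P ++ Q)                ∎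
  where open ≡-Reasoning

size-++-congʳ : ∀ U W W′ → size W ≡ size W′ → size (U ++ W) ≡ size (U ++ W′)
size-++-congʳ U W W′ sameSize = trans (size-++ U W) (trans (cong (size U +_) sameSize) (sym (size-++ U W′)))

EndsOnDiagonal-replace : ∀ U W W′ → endHeight (endHeight 0 U) W ≡ endHeight (endHeight 0 U) W′ →
                         size W ≡ size W′ → EndsOnDiagonal (U ++ W′) → EndsOnDiagonal (U ++ W)
EndsOnDiagonal-replace U W W′ sameHeight sameSize diag = begin
  endHeight 0 (U ++ W)           ≡⟨ endHeight-++ 0 U W ⟩
  endHeight (endHeight 0 U) W    ≡⟨ sameHeight ⟩
  endHeight (endHeight 0 U) W′   ≡⟨ sym (endHeight-++ 0 U W′) ⟩
  endHeight 0 (U ++ W′)          ≡⟨ diag ⟩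
  size (U ++ W′)                 ≡⟨ size-++-congʳ U W′ W (sym sameSize) ⟩
  size (U ++ W)                  ∎
  where open ≡-Reasoning

edges-split : ∀ U W → EndsOnDiagonal (U ++ W) →
  edges (U ++ W) ≡ edgesOfColumns 1 (columns U) ++ edgesOfColumns (suc (size U)) (columns′ (endHeight 0 U) W)
edges-split U W diag = begin
  edges (U ++ W)
    ≡⟨ edges≡edgesOfColumns (U ++ W) diag ⟩
  edgesOfColumns 1 (columns (U ++ W))
    ≡⟨ cong (edgesOfColumns 1) (columns′-++ 0 U W) ⟩
  edgesOfColumns 1 (columns U ++ columns′ (endHeight 0 U) W)
    ≡⟨ edgesOfColumns-++ 1 (columns U) _ ⟩
  edgesOfColumns 1 (columns U) ++ edgesOfColumns (suc (length (columns U))) (columns′ (endHeight 0 U) W)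
    ≡⟨ cong (λ i → edgesOfColumns 1 (columns U) ++ edgesOfColumns (suc i) (columns′ (endHeight 0 U) W))
            (length-columns′ 0 U) ⟩
  edgesOfColumns 1 (columns U) ++ edgesOfColumns (suc (size U)) (columns′ (endHeight 0 U) W) ∎
  where open ≡-Reasoning

edges-++ : ∀ {P Q} → IsSchroder P → IsSchroder Q →
           edges (P ++ Q) ≡ edges P ++ map (shiftEdge (size P)) (edges Q)
edges-++ {P} {Q} isP isQ = begin
  edges (P ++ Q)
    ≡⟨ edges-split P Q (EndsOnDiagonal-++ P Q diagP diagQ) ⟩
  edgesOfColumns 1 (columns P) ++ edgesOfColumns (suc m) (columns′ (endHeight 0 P) Q)
    ≡⟨ cong₂ _++_ (sym (edges≡edgesOfColumns P diagP)) shifted ⟩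
  edges P ++ map (shiftEdge m) (edges Q) ∎
  where
  open ≡-Reasoning
  m = size P
  diagP = IsSchroder⇒EndsOnDiagonal isP
  diagQ = IsSchroder⇒EndsOnDiagonal isQ
  shifted : edgesOfColumns (suc m) (columns′ (endHeight 0 P) Q) ≡ map (shiftEdge m) (edges Q)
  shifted = begin
    edgesOfColumns (suc m) (columns′ (endHeight 0 P) Q)
      ≡⟨ cong₂ edgesOfColumns (+-comm 1 m)
               (trans (cong (λ h → columns′ h Q) (trans diagP (sym (+-identityʳ m)))) (columns′-+ m 0 Q)) ⟩
    edgesOfColumns (m + 1) (map (shiftColumn m) (columns Q))
      ≡⟨ edgesOfColumns-+ m 1 (columns Q) ⟩
    map (shiftEdge m) (edgesOfColumns 1 (columns Q))
      ≡⟨ cong (map (shiftEdge m)) (sym (edges≡edgesOfColumns Q diagQ)) ⟩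
    map (shiftEdge m) (edges Q) ∎

record DifferInOneEdge (P₀ P₁ P₂ : List Step) : Set where
  field
    a b    : ℕ
    a<b    : a < b
    E R    : List Edge
    edges₀ : edges P₀ ≡ E ++ R
    edges₁ : edges P₁ ≡ E ++ edge a b false ∷ R
    edges₂ : edges P₂ ≡ E ++ edge a b true ∷ R

en-ne-d-differInOneEdge : ∀ U V → IsSchroder (U ++ d ∷ V) →
                          DifferInOneEdge (U ++ e ∷ n ∷ V) (U ++ n ∷ e ∷ V) (U ++ d ∷ V)
en-ne-d-differInOneEdge U V isS = record
  { a = a ; b = suc h ; a<b = s≤s a≤h ; E = L ++ lowerEdges a h ; R = R
  ; edges₀ = edges-en ; edges₁ = edges-ne ; edges₂ = edges-d }
  where
  open ≡-Reasoning
  h = endHeight 0 U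
  a = suc (size U)
  a≤h : a ≤ h
  a≤h = step-above-diagonal isS (λ ())
  L = edgesOfColumns 1 (columns U)
  R = edgesOfColumns (suc a) (columns′ (suc h) V)
  diag = IsSchroder⇒EndsOnDiagonal isS

  reassoc : ∀ (A B : List Edge) ε C → A ++ ((B ++ ε ∷ []) ++ C) ≡ (A ++ B) ++ ε ∷ C
  reassoc A B ε C = trans (cong (A ++_) (++-assoc B (ε ∷ []) C)) (sym (++-assoc A B (ε ∷ C)))

  edges-ne : edges (U ++ n ∷ e ∷ V) ≡ (L ++ lowerEdges a h) ++ edge a (suc h) false ∷ R
  edges-ne = begin
    edges (U ++ n ∷ e ∷ V)
      ≡⟨ edges-split U (n ∷ e ∷ V) (EndsOnDiagonal-replace U (n ∷ e ∷ V) (d ∷ V) refl (sym (size-d∷ V)) diag) ⟩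
    L ++ (edgesOfColumn a (e , suc h) ++ R)
      ≡⟨ cong (λ X → L ++ (X ++ R)) (trans (edgesOfColumn-e a (suc h)) (lowerEdges-suc a≤h)) ⟩
    L ++ ((lowerEdges a h ++ edge a (suc h) false ∷ []) ++ R)
      ≡⟨ reassoc L _ _ R ⟩
    (L ++ lowerEdges a h) ++ edge a (suc h) false ∷ R ∎

  edges-en : edges (U ++ e ∷ n ∷ V) ≡ (L ++ lowerEdges a h) ++ R
  edges-en = begin
    edges (U ++ e ∷ n ∷ V)
      ≡⟨ edges-split U (e ∷ n ∷ V) (EndsOnDiagonal-replace U (e ∷ n ∷ V) (d ∷ V) refl (sym (size-d∷ V)) diag) ⟩
    L ++ (edgesOfColumn a (e , h) ++ R)
      ≡⟨ cong (λ X → L ++ (X ++ R)) (edgesOfColumn-e a h) ⟩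
    L ++ (lowerEdges a h ++ R)
      ≡⟨ sym (++-assoc L _ R) ⟩
    (L ++ lowerEdges a h) ++ R ∎

  edges-d : edges (U ++ d ∷ V) ≡ (L ++ lowerEdges a h) ++ edge a (suc h) true ∷ R
  edges-d = begin
    edges (U ++ d ∷ V)
      ≡⟨ edges-split U (d ∷ V) diag ⟩
    L ++ (edgesOfColumn a (d , h) ++ R)
      ≡⟨ cong (λ X → L ++ (X ++ R)) (edgesOfColumn-d a≤h) ⟩
    L ++ ((lowerEdges a h ++ edge a (suc h) true ∷ []) ++ R)
      ≡⟨ reassoc L _ _ R ⟩
    (L ++ lowerEdges a h) ++ edge a (suc h) true ∷ R ∎

strictPathEdges : ℕ → ℕ → List Edge
strictPathEdges a zero    = []
strictPathEdges a (suc j) = edge a (suc a) true ∷ strictPathEdges (suc a) j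

edgesOfColumns-dʲe : ∀ a j →
  edgesOfColumns a (columns′ a (replicate j d ++ e ∷ [])) ≡ strictPathEdges a j
edgesOfColumns-dʲe a zero    =
  trans (++-identityʳ _) (trans (edgesOfColumn-e a a) (lowerEdges-≤ {a} ≤-refl))
edgesOfColumns-dʲe a (suc j) = cong₂ _++_
  (trans (edgesOfColumn-d ≤-refl) (cong (_++ edge a (suc a) true ∷ []) (lowerEdges-≤ {a} ≤-refl)))
  (edgesOfColumns-dʲe (suc a) j)

endHeight-dʲe : ∀ y j → endHeight y (replicate j d ++ e ∷ []) ≡ y + j
endHeight-dʲe y zero    = sym (+-identityʳ y)
endHeight-dʲe y (suc j) = trans (endHeight-dʲe (suc y) j) (sym (+-suc y j))

size-dʲe : ∀ j → size (replicate j d ++ e ∷ []) ≡ suc j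
size-dʲe zero    = refl
size-dʲe (suc j) = trans (size-d∷ (replicate j d ++ e ∷ [])) (cong suc (size-dʲe j))

edges-n-dᵏ-e : ∀ k → edges (n ∷ replicate k d ++ e ∷ []) ≡ strictPathEdges 1 k
edges-n-dᵏ-e k = trans
  (edges≡edgesOfColumns (n ∷ replicate k d ++ e ∷ []) (trans (endHeight-dʲe 1 k) (sym (size-dʲe k))))
  (edgesOfColumns-dʲe 1 k)

-- Sums over orientations

sumMap : ∀ {A : Set} → (A → ℤ) → List A → ℤ
sumMap W xs = sumℤ (map W xs)

sumℤ-++ : ∀ xs ys → sumℤ (xs ++ ys) ≡ sumℤ xs ℤ.+ sumℤ ys
sumℤ-++ []       ys = sym (ℤ.+-identityˡ _)
sumℤ-++ (x ∷ xs) ys = trans (cong (ℤ._+_ x) (sumℤ-++ xs ys)) (sym (ℤ.+-assoc x _ _))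

sumMap-++ : ∀ {A : Set} (W : A → ℤ) xs ys → sumMap W (xs ++ ys) ≡ sumMap W xs ℤ.+ sumMap W ys
sumMap-++ W xs ys = trans (cong sumℤ (map-++ W xs ys)) (sumℤ-++ (map W xs) (map W ys))

sumMap-map : ∀ {A B : Set} (W : B → ℤ) (g : A → B) xs → sumMap W (map g xs) ≡ sumMap (W ∘ g) xs
sumMap-map W g xs = cong sumℤ (sym (map-∘ xs))

sumMap-cong : ∀ {A : Set} {W W′ : A → ℤ} → (∀ x → W x ≡ W′ x) →
              ∀ xs → sumMap W xs ≡ sumMap W′ xs
sumMap-cong W≗W′ xs = cong sumℤ (map-cong W≗W′ xs)

sumMap-cong-local : ∀ {A : Set} {W W′ : A → ℤ} {xs} →
                    All (λ x → W x ≡ W′ x) xs → sumMap W xs ≡ sumMap W′ xs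
sumMap-cong-local = cong sumℤ ∘ map-cong-local

sumMap-+ : ∀ {A : Set} (W W′ : A → ℤ) xs →
           sumMap (λ x → W x ℤ.+ W′ x) xs ≡ sumMap W xs ℤ.+ sumMap W′ xs
sumMap-+ W W′ []       = refl
sumMap-+ W W′ (x ∷ xs) =
  trans (cong (ℤ._+_ (W x ℤ.+ W′ x)) (sumMap-+ W W′ xs)) (+-interchange (W x) (W′ x) _ _)

sumMap-*ˡ : ∀ {A : Set} c (W : A → ℤ) xs → sumMap (λ x → c * W x) xs ≡ c * sumMap W xs
sumMap-*ˡ c W []       = sym (ℤ.*-zeroʳ c)
sumMap-*ˡ c W (x ∷ xs) =
  trans (cong (ℤ._+_ (c * W x)) (sumMap-*ˡ c W xs)) (sym (ℤ.*-distribˡ-+ c (W x) _))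

sumMap-*ʳ : ∀ {A : Set} c (W : A → ℤ) xs → sumMap (λ x → W x * c) xs ≡ sumMap W xs * c
sumMap-*ʳ c W []       = refl
sumMap-*ʳ c W (x ∷ xs) =
  trans (cong (ℤ._+_ (W x * c)) (sumMap-*ʳ c W xs)) (sym (ℤ.*-distribʳ-+ c (W x) _))

orientationsOfEdge : Edge → List Arc
orientationsOfEdge (edge a b true)  = arc a b true ∷ []
orientationsOfEdge (edge a b false) = arc a b false ∷ arc b a false ∷ []

sumOrientations : (List Arc → ℤ) → List Edge → ℤ
sumOrientations W E = sumMap W (orientationsOf E)

sumOrientations-∷ : ∀ W ε E →
  sumOrientations W (ε ∷ E) ≡ sumMap (λ α → sumOrientations (λ θ → W (α ∷ θ)) E) (orientationsOfEdge ε)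
sumOrientations-∷ W (edge a b true)  E =
  trans (sumMap-map W (arc a b true ∷_) (orientationsOf E)) (sym (ℤ.+-identityʳ _))
sumOrientations-∷ W (edge a b false) E = trans (sumMap-++ W (map (arc a b false ∷_) (orientationsOf E)) _)
  (cong₂ ℤ._+_ (sumMap-map W _ (orientationsOf E))
               (trans (sumMap-map W _ (orientationsOf E)) (sym (ℤ.+-identityʳ _))))

sumOrientations-++ : ∀ W E E′ →
  sumOrientations W (E ++ E′) ≡ sumOrientations (λ θ → sumOrientations (λ θ′ → W (θ ++ θ′)) E′) E
sumOrientations-++ W []      E′ = sym (ℤ.+-identityʳ _)
sumOrientations-++ W (ε ∷ E) E′ = begin
  sumOrientations W (ε ∷ E ++ E′)
    ≡⟨ sumOrientations-∷ W ε (E ++ E′) ⟩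
  sumMap (λ α → sumOrientations (λ θ → W (α ∷ θ)) (E ++ E′)) (orientationsOfEdge ε)
    ≡⟨ sumMap-cong (λ α → sumOrientations-++ (λ θ → W (α ∷ θ)) E E′) (orientationsOfEdge ε) ⟩
  sumMap (λ α → sumOrientations (λ θ → sumOrientations (λ θ′ → W (α ∷ θ ++ θ′)) E′) E) (orientationsOfEdge ε)
    ≡⟨ sym (sumOrientations-∷ _ ε E) ⟩
  sumOrientations (λ θ → sumOrientations (λ θ′ → W (θ ++ θ′)) E′) (ε ∷ E) ∎
  where open ≡-Reasoning

shiftArc : ℕ → Arc → Arc
shiftArc m (arc x y s) = arc (m + x) (m + y) s

orientationsOfEdge-shift : ∀ m ε →
  orientationsOfEdge (shiftEdge m ε) ≡ map (shiftArc m) (orientationsOfEdge ε)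
orientationsOfEdge-shift m (edge a b true)  = refl
orientationsOfEdge-shift m (edge a b false) = refl

sumOrientations-shift : ∀ m W E →
  sumOrientations W (map (shiftEdge m) E) ≡ sumOrientations (W ∘ map (shiftArc m)) E
sumOrientations-shift m W []      = refl
sumOrientations-shift m W (ε ∷ E) = begin
  sumOrientations W (shiftEdge m ε ∷ map (shiftEdge m) E)
    ≡⟨ sumOrientations-∷ W (shiftEdge m ε) _ ⟩
  sumMap rest (orientationsOfEdge (shiftEdge m ε))
    ≡⟨ cong (sumMap rest) (orientationsOfEdge-shift m ε) ⟩
  sumMap rest (map (shiftArc m) (orientationsOfEdge ε))
    ≡⟨ sumMap-map rest (shiftArc m) (orientationsOfEdge ε) ⟩
  sumMap (rest ∘ shiftArc m) (orientationsOfEdge ε)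
    ≡⟨ sumMap-cong (λ α → sumOrientations-shift m (λ θ → W (shiftArc m α ∷ θ)) E) (orientationsOfEdge ε) ⟩
  sumMap (λ α → sumOrientations (λ θ → W (shiftArc m α ∷ map (shiftArc m) θ)) E) (orientationsOfEdge ε)
    ≡⟨ sym (sumOrientations-∷ (W ∘ map (shiftArc m)) ε E) ⟩
  sumOrientations (W ∘ map (shiftArc m)) (ε ∷ E) ∎
  where
  open ≡-Reasoning
  rest : Arc → ℤ
  rest α = sumOrientations (λ θ → W (α ∷ θ)) (map (shiftEdge m) E)

-- Reachability

Digraph : Set
Digraph = List (ℕ × ℕ)

reachable : Digraph → ℕ → ℕ → List ℕ
reachableVia : Digraph → ℕ → ℕ → ℕ × ℕ → List ℕ

reachable G zero    u = u ∷ []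
reachable G (suc f) u = u ∷ concatMap (reachableVia G f u) G

reachableVia G f u (x , y) = if x ≡ᵇ u then reachable G f y else []

usableDigraph : List Arc → Digraph
usableDigraph []      = []
usableDigraph (α ∷ θ) =
  if usable α then (Arc.src α , Arc.tgt α) ∷ usableDigraph θ else usableDigraph θ

reach≡reachable : ∀ θ f u → reach θ f u ≡ reachable (usableDigraph θ) f u
reach≡reachable θ zero    u = refl
reach≡reachable θ (suc f) u = cong (u ∷_) (steps θ)
  where
  steps : ∀ ψ → concatMap (λ α → if (Arc.src α ≡ᵇ u) ∧ usable α then reach θ f (Arc.tgt α) else []) ψ
              ≡ concatMap (reachableVia (usableDigraph θ) f u) (usableDigraph ψ)
  steps []      = refl
  steps (α ∷ ψ) with usable α
  ... | true with Arc.src α ≡ᵇ u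
  ...   | true  = cong₂ _++_ (reach≡reachable θ f (Arc.tgt α)) (steps ψ)
  ...   | false = steps ψ
  steps (α ∷ ψ) | false with Arc.src α ≡ᵇ u
  ...   | true  = steps ψ
  ...   | false = steps ψ

reachableVia-skip : ∀ {G f u} p → proj₁ p ≢ u → reachableVia G f u p ≡ []
reachableVia-skip p x≢u rewrite ≡ᵇ-false x≢u = refl

reachableVia-take : ∀ {G f} u y → reachableVia G f u (u , y) ≡ reachable G f y
reachableVia-take u y rewrite ≡ᵇ-refl u = refl

no-exit : ∀ {B G} → All (Upward B) G → ∀ {f u} → B ≤ u → concatMap (reachableVia G f u) G ≡ []
no-exit up B≤u = concatMap-nil
  (All.map (λ {p} (_ , x<y , y≤B) → reachableVia-skip p (<⇒≢ (<-≤-trans x<y (≤-trans y≤B B≤u)))) up)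

reachable-fuel : ∀ {B G} → All (Upward B) G → ∀ f f′ u → B ≤ u + f → B ≤ u + f′ →
                 reachable G f u ≡ reachable G f′ u
reachable-fuel up zero    zero     u _   _   = refl
reachable-fuel up zero    (suc f′) u B≤u _   = cong (u ∷_) (sym (no-exit up (subst (_ ≤_) (+-identityʳ u) B≤u)))
reachable-fuel up (suc f) zero     u _   B≤u = cong (u ∷_) (no-exit up (subst (_ ≤_) (+-identityʳ u) B≤u))
reachable-fuel {B} {G} up (suc f) (suc f′) u B≤u+1+f B≤u+1+f′ =
  cong (u ∷_) (concatMap-cong-local (All.map step up))
  where
  step : ∀ {p} → Upward B p → reachableVia G f u p ≡ reachableVia G f′ u p
  step {x , y} (_ , x<y , _) with x ≡ᵇ u in x≡ᵇu
  ... | false = refl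
  ... | true  = reachable-fuel up f f′ y (further B≤u+1+f) (further B≤u+1+f′)
    where
    u<y : u < y
    u<y = subst (_< y) (≡ᵇ≡true⇒≡ x≡ᵇu) x<y
    further : ∀ {g} → B ≤ u + suc g → B ≤ y + g
    further {g} B≤ = ≤-trans B≤ (subst (_≤ y + g) (sym (+-suc u g)) (+-monoˡ-≤ g u<y))

shiftPair : ℕ → ℕ × ℕ → ℕ × ℕ
shiftPair m (x , y) = m + x , m + y

reachable-low : ∀ {m k GP GQ} → All (Upward m) GP → All (Upward k) GQ → ∀ f {u} → u ≤ m →
                reachable (GP ++ map (shiftPair m) GQ) f u ≡ reachable GP f u
reachable-low upP upQ zero    u≤m = refl
reachable-low {m} {k} {GP} {GQ} upP upQ (suc f) {u} u≤m = cong (u ∷_) (begin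
  concatMap via (GP ++ map (shiftPair m) GQ)
    ≡⟨ concatMap-++ via GP _ ⟩
  concatMap via GP ++ concatMap via (map (shiftPair m) GQ)
    ≡⟨ cong₂ _++_ (concatMap-cong-local (All.map inP upP))
                  (trans (concatMap-map via (shiftPair m) GQ) (concatMap-nil (All.map inQ upQ))) ⟩
  concatMap (reachableVia GP f u) GP ++ []
    ≡⟨ ++-identityʳ _ ⟩
  concatMap (reachableVia GP f u) GP ∎)
  where
  open ≡-Reasoning
  via = reachableVia (GP ++ map (shiftPair m) GQ) f u
  inP : ∀ {p} → Upward m p → via p ≡ reachableVia GP f u p
  inP {x , y} (_ , _ , y≤m) = cong (λ L → if x ≡ᵇ u then L else []) (reachable-low upP upQ f y≤m)
  inQ : ∀ {p} → Upward k p → via (shiftPair m p) ≡ []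
  inQ {p} (1≤x , _) = reachableVia-skip (shiftPair m p) (>⇒≢ (≤-<-trans u≤m (m<m+n m 1≤x)))

reachable-high : ∀ {m GP} GQ → All (Upward m) GP → ∀ f u →
                 reachable (GP ++ map (shiftPair m) GQ) f (m + u) ≡ map (m +_) (reachable GQ f u)
reachable-high GQ upP zero    u = refl
reachable-high {m} {GP} GQ upP (suc f) u = cong ((m + u) ∷_) (begin
  concatMap via (GP ++ map (shiftPair m) GQ)
    ≡⟨ concatMap-++ via GP _ ⟩
  concatMap via GP ++ concatMap via (map (shiftPair m) GQ)
    ≡⟨ cong₂ _++_ (concatMap-nil (All.map inP upP)) (concatMap-map via (shiftPair m) GQ) ⟩
  concatMap (via ∘ shiftPair m) GQ
    ≡⟨ concatMap-cong inQ GQ ⟩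
  concatMap (map (m +_) ∘ reachableVia GQ f u) GQ
    ≡⟨ sym (map-concatMap (m +_) (reachableVia GQ f u) GQ) ⟩
  map (m +_) (concatMap (reachableVia GQ f u) GQ) ∎)
  where
  open ≡-Reasoning
  via = reachableVia (GP ++ map (shiftPair m) GQ) f (m + u)
  inP : ∀ {p} → Upward m p → via p ≡ []
  inP {p} (_ , x<y , y≤m) = reachableVia-skip p (<⇒≢ (<-≤-trans x<y (≤-trans y≤m (m≤m+n m u))))
  inQ : ∀ p → via (shiftPair m p) ≡ map (m +_) (reachableVia GQ f u p)
  inQ (x , y) = begin
    (if m + x ≡ᵇ m + u then reachable (GP ++ map (shiftPair m) GQ) f (m + y) else [])
      ≡⟨ cong₂ (λ c L → if c then L else []) (≡ᵇ-+ m x u) (reachable-high GQ upP f y) ⟩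
    (if x ≡ᵇ u then map (m +_) (reachable GQ f y) else [])
      ≡⟨ sym (if-float (map (m +_)) (x ≡ᵇ u)) ⟩
    map (m +_) (reachableVia GQ f u (x , y)) ∎

reachable-bounded : ∀ {B G} → All (Upward B) G → ∀ f {u} → u ≤ B → All (_≤ B) (reachable G f u)
reachable-bounded up zero    u≤B = u≤B ∷ []
reachable-bounded {B} {G} up (suc f) {u} u≤B = u≤B ∷ concat⁺ (map⁺ (All.map step up))
  where
  step : ∀ {p} → Upward B p → All (_≤ B) (reachableVia G f u p)
  step {x , y} (_ , _ , y≤B) with x ≡ᵇ u
  ... | true  = reachable-bounded up f y≤B
  ... | false = []

maxℕ-reachable-≥ : ∀ G f u → u ≤ maxℕ (reachable G f u)
maxℕ-reachable-≥ G zero    u = m≤m⊔n u 0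
maxℕ-reachable-≥ G (suc f) u = m≤m⊔n u _

maxℕ-reachable-shift : ∀ m G f u → maxℕ (map (m +_) (reachable G f u)) ≡ m + maxℕ (reachable G f u)
maxℕ-reachable-shift m G zero    u = maxℕ-shift m u []
maxℕ-reachable-shift m G (suc f) u = maxℕ-shift m u (concatMap (reachableVia G f u) G)

maxℕ-reachable-step : ∀ {G f u y} → (u , y) ∈ G →
                      maxℕ (reachable G f y) ≤ maxℕ (reachable G (suc f) u)
maxℕ-reachable-step {G} {f} {u} {y} u→y = ≤-trans
  (subst (λ L → maxℕ L ≤ _) (reachableVia-take u y) (maxℕ-concatMap (reachableVia G f u) u→y))
  (m≤n⊔m u _)

-- The highest reachable vertex and the partition λ(θ)

usableDigraph-++ : ∀ θ θ′ → usableDigraph (θ ++ θ′) ≡ usableDigraph θ ++ usableDigraph θ′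
usableDigraph-++ []      θ′ = refl
usableDigraph-++ (α ∷ θ) θ′ with usable α
... | true  = cong ((Arc.src α , Arc.tgt α) ∷_) (usableDigraph-++ θ θ′)
... | false = usableDigraph-++ θ θ′

usableDigraph-shift : ∀ m θ → usableDigraph (map (shiftArc m) θ) ≡ map (shiftPair m) (usableDigraph θ)
usableDigraph-shift m []                  = refl
usableDigraph-shift m (arc x y true ∷ θ)  = cong ((m + x , m + y) ∷_) (usableDigraph-shift m θ)
usableDigraph-shift m (arc x y false ∷ θ) rewrite <ᵇ-+ m x y with x <ᵇ y
... | true  = cong ((m + x , m + y) ∷_) (usableDigraph-shift m θ)
... | false = usableDigraph-shift m θ

usableDigraph-ascending : ∀ θ {a b} → a < b → ∀ θ′ →
                          usableDigraph (θ ++ arc a b false ∷ θ′) ≡ usableDigraph (θ ++ arc a b true ∷ θ′)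
usableDigraph-ascending θ {a} {b} a<b θ′ =
  trans (usableDigraph-++ θ _) (trans (cong (usableDigraph θ ++_) cons) (sym (usableDigraph-++ θ _)))
  where
  cons : usableDigraph (arc a b false ∷ θ′) ≡ usableDigraph (arc a b true ∷ θ′)
  cons rewrite <ᵇ-true a<b = refl

usableDigraph-descending : ∀ θ {a b} → a < b → ∀ θ′ →
                           usableDigraph (θ ++ arc b a false ∷ θ′) ≡ usableDigraph (θ ++ θ′)
usableDigraph-descending θ {a} {b} a<b θ′ =
  trans (usableDigraph-++ θ _) (trans (cong (usableDigraph θ ++_) cons) (sym (usableDigraph-++ θ θ′)))
  where
  cons : usableDigraph (arc b a false ∷ θ′) ≡ usableDigraph θ′
  cons rewrite <ᵇ-false (<⇒≤ a<b) = refl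

orientations-upward : ∀ {B} E → All (Upward B ∘ endpoints) E →
                      All (λ θ → All (Upward B) (usableDigraph θ)) (orientationsOf E)
orientations-upward []                   []          = [] ∷ []
orientations-upward (edge x y true ∷ E)  (up ∷ ups) = map⁺ (All.map (up ∷_) (orientations-upward E ups))
orientations-upward {B} (edge x y false ∷ E) (up@(_ , x<y , _) ∷ ups) = ++⁺
  (map⁺ (All.map (λ {θ} upθ → subst (All (Upward B)) (sym (usableDigraph-ascending [] x<y θ)) (up ∷ upθ)) rec))
  (map⁺ (All.map (λ {θ} upθ → subst (All (Upward B)) (sym (usableDigraph-descending [] x<y θ)) upθ) rec))
  where rec = orientations-upward E ups

hrv≡ : ∀ sz θ u → hrv sz θ u ≡ maxℕ (reachable (usableDigraph θ) sz u)
hrv≡ sz θ u = cong maxℕ (reach≡reachable θ sz u)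

hrv-cong : ∀ {θ θ′} → usableDigraph θ ≡ usableDigraph θ′ → ∀ sz u → hrv sz θ u ≡ hrv sz θ′ u
hrv-cong {θ} {θ′} same sz u =
  trans (hrv≡ sz θ u) (trans (cong (λ G → maxℕ (reachable G sz u)) same) (sym (hrv≡ sz θ′ u)))

hrv-IsVertex : ∀ {sz θ} → All (Upward sz) (usableDigraph θ) →
               ∀ {u} → IsVertex sz u → IsVertex sz (hrv sz θ u)
hrv-IsVertex {sz} {θ} up {u} (1≤u , u≤sz) = subst (IsVertex sz) (sym (hrv≡ sz θ u))
  (≤-trans 1≤u (maxℕ-reachable-≥ _ sz u) , maxℕ-≤ (reachable-bounded up sz u≤sz))

usableDigraph-blocks : ∀ m θP θQ →
  usableDigraph (θP ++ map (shiftArc m) θQ) ≡ usableDigraph θP ++ map (shiftPair m) (usableDigraph θQ)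
usableDigraph-blocks m θP θQ =
  trans (usableDigraph-++ θP _) (cong (usableDigraph θP ++_) (usableDigraph-shift m θQ))

hrv-low : ∀ {m k} θP θQ → All (Upward m) (usableDigraph θP) → All (Upward k) (usableDigraph θQ) →
          ∀ {u} → u ≤ m → hrv (m + k) (θP ++ map (shiftArc m) θQ) u ≡ hrv m θP u
hrv-low {m} {k} θP θQ upP upQ {u} u≤m = begin
  hrv (m + k) (θP ++ map (shiftArc m) θQ) u
    ≡⟨ hrv≡ (m + k) _ u ⟩
  maxℕ (reachable (usableDigraph (θP ++ map (shiftArc m) θQ)) (m + k) u)
    ≡⟨ cong (λ G → maxℕ (reachable G (m + k) u)) (usableDigraph-blocks m θP θQ) ⟩
  maxℕ (reachable (GP ++ map (shiftPair m) (usableDigraph θQ)) (m + k) u)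
    ≡⟨ cong maxℕ (reachable-low upP upQ (m + k) u≤m) ⟩
  maxℕ (reachable GP (m + k) u)
    ≡⟨ cong maxℕ (reachable-fuel upP (m + k) m u (≤-trans (m≤m+n m k) (m≤n+m _ u)) (m≤n+m m u)) ⟩
  maxℕ (reachable GP m u)
    ≡⟨ sym (hrv≡ m θP u) ⟩
  hrv m θP u ∎
  where
  open ≡-Reasoning
  GP = usableDigraph θP

hrv-high : ∀ {m k} θP θQ → All (Upward m) (usableDigraph θP) → All (Upward k) (usableDigraph θQ) →
           ∀ u → hrv (m + k) (θP ++ map (shiftArc m) θQ) (m + u) ≡ m + hrv k θQ u
hrv-high {m} {k} θP θQ upP upQ u = begin
  hrv (m + k) (θP ++ map (shiftArc m) θQ) (m + u)
    ≡⟨ hrv≡ (m + k) _ (m + u) ⟩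
  maxℕ (reachable (usableDigraph (θP ++ map (shiftArc m) θQ)) (m + k) (m + u))
    ≡⟨ cong (λ G → maxℕ (reachable G (m + k) (m + u))) (usableDigraph-blocks m θP θQ) ⟩
  maxℕ (reachable (usableDigraph θP ++ map (shiftPair m) GQ) (m + k) (m + u))
    ≡⟨ cong maxℕ (reachable-high GQ upP (m + k) u) ⟩
  maxℕ (map (m +_) (reachable GQ (m + k) u))
    ≡⟨ maxℕ-reachable-shift m GQ (m + k) u ⟩
  m + maxℕ (reachable GQ (m + k) u)
    ≡⟨ cong (λ L → m + maxℕ L)
            (reachable-fuel upQ (m + k) k u (≤-trans (m≤n+m k m) (m≤n+m _ u)) (m≤n+m k u)) ⟩
  m + maxℕ (reachable GQ k u)
    ≡⟨ cong (m +_) (sym (hrv≡ k θQ u)) ⟩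
  m + hrv k θQ u ∎
  where
  open ≡-Reasoning
  GQ = usableDigraph θQ

classSize : ℕ → (ℕ → ℕ) → ℕ → ℕ
classSize sz H c = length (filter (λ u → H u ≟ c) (vertices sz))

-- λ(θ) is 'classSizes sz (hrv sz θ)' on the nose
classSizes : ℕ → (ℕ → ℕ) → List ℕ
classSizes sz H = filter (λ c → ¬? (c ≟ 0)) (map (classSize sz H) (vertices sz))

classSizes-cong : ∀ sz {H H′ : ℕ → ℕ} → (∀ u → H u ≡ H′ u) → classSizes sz H ≡ classSizes sz H′
classSizes-cong sz {H} {H′} H≗H′ = cong (filter _) (map-cong sameClass (vertices sz))
  where
  sameClass : ∀ c → classSize sz H c ≡ classSize sz H′ c
  sameClass c = cong length (filter-≐ (λ u → H u ≟ c) (λ u → H′ u ≟ c)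
    ((λ {u} → trans (sym (H≗H′ u))) , (λ {u} → trans (H≗H′ u))) (vertices sz))

length-vertices : ∀ k → length (vertices k) ≡ k
length-vertices k = trans (length-map suc (upTo k)) (length-upTo k)

classSizes-++ : ∀ m k (H HP HQ : ℕ → ℕ) →
  (∀ {u} → IsVertex m u → H u ≡ HP u) →
  (∀ {u} → IsVertex m u → IsVertex m (HP u)) →
  (∀ {u} → IsVertex k u → H (m + u) ≡ m + HQ u) →
  (∀ {u} → IsVertex k u → IsVertex k (HQ u)) →
  classSizes (m + k) H ≡ classSizes m HP ++ classSizes k HQ
classSizes-++ m k H HP HQ low HP-into high HQ-into = begin
  filter nz (map cs (vertices (m + k)))
    ≡⟨ cong (filter nz ∘ map cs) (vertices-+ m k) ⟩
  filter nz (map cs (vertices m ++ map (m +_) (vertices k)))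
    ≡⟨ cong (filter nz) (map-++ cs (vertices m) _) ⟩
  filter nz (map cs (vertices m) ++ map cs (map (m +_) (vertices k)))
    ≡⟨ filter-++ nz (map cs (vertices m)) _ ⟩
  filter nz (map cs (vertices m)) ++ filter nz (map cs (map (m +_) (vertices k)))
    ≡⟨ cong₂ (λ A B → filter nz A ++ filter nz B)
             (map-cong-local (All.map classSize-low (vertices-IsVertex m)))
             (trans (sym (map-∘ (vertices k))) (map-cong-local (All.map classSize-high (vertices-IsVertex k)))) ⟩
  classSizes m HP ++ classSizes k HQ ∎
  where
  open ≡-Reasoning
  nz = λ c → ¬? (c ≟ 0)
  cs = classSize (m + k) H
  hits : ℕ → List ℕ → ℕ
  hits c us = length (filter (λ u → H u ≟ c) us)

  classSize-split : ∀ c → cs c ≡ hits c (vertices m) + hits c (map (m +_) (vertices k))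
  classSize-split c = trans (cong (hits c) (vertices-+ m k))
    (trans (cong length (filter-++ (λ u → H u ≟ c) (vertices m) _)) (length-++ (filter _ (vertices m))))

  classSize-low : ∀ {c} → IsVertex m c → cs c ≡ classSize m HP c
  classSize-low {c} (_ , c≤m) = begin
    cs c
      ≡⟨ classSize-split c ⟩
    hits c (vertices m) + hits c (map (m +_) (vertices k))
      ≡⟨ cong₂ _+_ inP (cong length (filter-none _ (map⁺ (All.map missQ (vertices-IsVertex k))))) ⟩
    classSize m HP c + 0
      ≡⟨ +-identityʳ _ ⟩
    classSize m HP c ∎
    where
    inP : hits c (vertices m) ≡ classSize m HP c
    inP = cong length (filter-cong-local _ _
      (All.map (λ u∈ → mk⇔ (trans (sym (low u∈))) (trans (low u∈))) (vertices-IsVertex m)))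
    missQ : ∀ {u} → IsVertex k u → H (m + u) ≢ c
    missQ u∈ Hu≡c = <⇒≢ (≤-<-trans c≤m (m<m+n m (proj₁ (HQ-into u∈)))) (trans (sym Hu≡c) (high u∈))

  classSize-high : ∀ {c} → IsVertex k c → cs (m + c) ≡ classSize k HQ c
  classSize-high {c} (1≤c , _) = begin
    cs (m + c)
      ≡⟨ classSize-split (m + c) ⟩
    hits (m + c) (vertices m) + hits (m + c) (map (m +_) (vertices k))
      ≡⟨ cong₂ _+_ (cong length (filter-none _ (All.map missP (vertices-IsVertex m)))) inQ ⟩
    classSize k HQ c ∎
    where
    missP : ∀ {u} → IsVertex m u → H u ≢ m + c
    missP u∈ Hu≡m+c = <⇒≢ (≤-<-trans (proj₂ (HP-into u∈)) (m<m+n m 1≤c)) (trans (sym (low u∈)) Hu≡m+c)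
    inQ : hits (m + c) (map (m +_) (vertices k)) ≡ classSize k HQ c
    inQ = trans (length-filter-map (λ u → H u ≟ m + c) (m +_) (vertices k))
                (cong length (filter-cong-local _ _ (All.map hitQ (vertices-IsVertex k))))
      where
      hitQ : ∀ {u} → IsVertex k u → H (m + u) ≡ m + c ⇔ HQ u ≡ c
      hitQ u∈ = mk⇔ (λ eq → +-cancelˡ-≡ m _ _ (trans (sym (high u∈)) eq))
                    (λ eq → trans (high u∈) (cong (m +_) eq))

classSizes-const : ∀ k (H : ℕ → ℕ) → (∀ {u} → IsVertex (suc k) u → H u ≡ suc k) →
                   classSizes (suc k) H ≡ suc k ∷ []
classSizes-const k H const = begin
  filter nz (map cs (vertices (suc k)))
    ≡⟨ cong (filter nz ∘ map cs) (vertices-suc k) ⟩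
  filter nz (map cs (vertices k ++ suc k ∷ []))
    ≡⟨ cong (filter nz) (map-++ cs (vertices k) _) ⟩
  filter nz (map cs (vertices k) ++ cs (suc k) ∷ [])
    ≡⟨ filter-++ nz (map cs (vertices k)) _ ⟩
  filter nz (map cs (vertices k)) ++ filter nz (cs (suc k) ∷ [])
    ≡⟨ cong₂ (λ A c → A ++ filter nz (c ∷ [])) noSmallClass fullClass ⟩
  suc k ∷ [] ∎
  where
  open ≡-Reasoning
  nz = λ c → ¬? (c ≟ 0)
  cs = classSize (suc k) H
  emptyClass : ∀ {c} → IsVertex k c → cs c ≡ 0
  emptyClass {c} (_ , c≤k) = cong length (filter-none (λ u → H u ≟ c)
    (All.map (λ u∈ Hu≡c → <⇒≢ (s≤s c≤k) (trans (sym Hu≡c) (const u∈))) (vertices-IsVertex (suc k))))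
  noSmallClass : filter nz (map cs (vertices k)) ≡ []
  noSmallClass = filter-none nz (map⁺ (All.map (λ c∈ c≢0 → c≢0 (emptyClass c∈)) (vertices-IsVertex k)))
  fullClass : cs (suc k) ≡ suc k
  fullClass = trans (cong length (filter-all (λ u → H u ≟ suc k) (All.map const (vertices-IsVertex (suc k)))))
                    (length-vertices (suc k))

lam-cong : ∀ {θ θ′} → usableDigraph θ ≡ usableDigraph θ′ → ∀ sz → lam sz θ ≡ lam sz θ′
lam-cong same sz = classSizes-cong sz (hrv-cong same sz)

lam-blocks : ∀ {m k} θP θQ → All (Upward m) (usableDigraph θP) → All (Upward k) (usableDigraph θQ) →
             lam (m + k) (θP ++ map (shiftArc m) θQ) ≡ lam m θP ++ lam k θQ
lam-blocks {m} {k} θP θQ upP upQ = classSizes-++ m k _ (hrv m θP) (hrv k θQ)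
  (λ (_ , u≤m) → hrv-low θP θQ upP upQ u≤m) (hrv-IsVertex upP)
  (λ {u} _ → hrv-high θP θQ upP upQ u) (hrv-IsVertex upQ)

-- Weights

ascIndicator : Arc → ℕ
ascIndicator α = if isAscending α then 1 else 0

asc-∷ : ∀ α θ → asc (α ∷ θ) ≡ ascIndicator α + asc θ
asc-∷ α θ with isAscending α
... | true  = refl
... | false = refl

asc-++ : ∀ θ θ′ → asc (θ ++ θ′) ≡ asc θ + asc θ′
asc-++ θ θ′ = trans (cong length (filter-++ _ θ θ′)) (length-++ (filter _ θ))

isAscending-shift : ∀ m α → isAscending (shiftArc m α) ≡ isAscending α
isAscending-shift m (arc x y s) = cong (not s ∧_) (<ᵇ-+ m x y)

asc-shift : ∀ m θ → asc (map (shiftArc m) θ) ≡ asc θ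
asc-shift m []      = refl
asc-shift m (α ∷ θ) = begin
  asc (shiftArc m α ∷ map (shiftArc m) θ)
    ≡⟨ asc-∷ (shiftArc m α) _ ⟩
  ascIndicator (shiftArc m α) + asc (map (shiftArc m) θ)
    ≡⟨ cong₂ _+_ (cong (λ b → if b then 1 else 0) (isAscending-shift m α)) (asc-shift m θ) ⟩
  ascIndicator α + asc θ
    ≡⟨ sym (asc-∷ α θ) ⟩
  asc (α ∷ θ) ∎
  where open ≡-Reasoning

asc-ascending : ∀ θ {a b} → a < b → ∀ θ′ →
                asc (θ ++ arc a b false ∷ θ′) ≡ suc (asc (θ ++ arc a b true ∷ θ′))
asc-ascending θ {a} {b} a<b θ′ = begin
  asc (θ ++ arc a b false ∷ θ′)            ≡⟨ asc-++ θ _ ⟩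
  asc θ + asc (arc a b false ∷ θ′)         ≡⟨ cong (asc θ +_) cons ⟩
  asc θ + suc (asc θ′)                     ≡⟨ +-suc (asc θ) (asc θ′) ⟩
  suc (asc θ + asc (arc a b true ∷ θ′))    ≡⟨ cong suc (sym (asc-++ θ _)) ⟩
  suc (asc (θ ++ arc a b true ∷ θ′))       ∎
  where
  open ≡-Reasoning
  cons : asc (arc a b false ∷ θ′) ≡ suc (asc θ′)
  cons rewrite <ᵇ-true a<b = refl

asc-descending : ∀ θ {a b} → a < b → ∀ θ′ → asc (θ ++ arc b a false ∷ θ′) ≡ asc (θ ++ θ′)
asc-descending θ {a} {b} a<b θ′ =
  trans (asc-++ θ _) (trans (cong (asc θ +_) cons) (sym (asc-++ θ θ′)))
  where
  cons : asc (arc b a false ∷ θ′) ≡ asc θ′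
  cons rewrite <ᵇ-false (<⇒≤ a<b) = refl

eλ-++ : ∀ A C xs → eλ (A ++ C) xs ≡ eλ A xs * eλ C xs
eλ-++ []      C xs = sym (ℤ.*-identityˡ _)
eλ-++ (a ∷ A) C xs = trans (cong (eSym a xs *_) (eλ-++ A C xs)) (sym (ℤ.*-assoc (eSym a xs) _ _))

weight : ℤ → List ℤ → ℕ → List Arc → ℤ
weight q xs sz θ = q ^ asc θ * eλ (lam sz θ) xs

-- F_P q xs is 'FΓ (size P) (edges P) q xs' on the nose
FΓ : ℕ → List Edge → ℤ → List ℤ → ℤ
FΓ sz E q xs = sumOrientations (weight q xs sz) E

weight-ascending : ∀ q xs sz θ {a b} → a < b → ∀ θ′ →
                   weight q xs sz (θ ++ arc a b false ∷ θ′) ≡ q * weight q xs sz (θ ++ arc a b true ∷ θ′)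
weight-ascending q xs sz θ a<b θ′ = trans
  (cong₂ (λ i L → q ^ i * eλ L xs) (asc-ascending θ a<b θ′) (lam-cong (usableDigraph-ascending θ a<b θ′) sz))
  (ℤ.*-assoc q _ _)

weight-descending : ∀ q xs sz θ {a b} → a < b → ∀ θ′ →
                    weight q xs sz (θ ++ arc b a false ∷ θ′) ≡ weight q xs sz (θ ++ θ′)
weight-descending q xs sz θ a<b θ′ =
  cong₂ (λ i L → q ^ i * eλ L xs) (asc-descending θ a<b θ′) (lam-cong (usableDigraph-descending θ a<b θ′) sz)

weight-blocks : ∀ q xs {m k} θP θQ → All (Upward m) (usableDigraph θP) → All (Upward k) (usableDigraph θQ) →
                weight q xs (m + k) (θP ++ map (shiftArc m) θQ) ≡ weight q xs m θP * weight q xs k θQ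
weight-blocks q xs {m} {k} θP θQ upP upQ = begin
  q ^ asc (θP ++ map (shiftArc m) θQ) * eλ (lam (m + k) (θP ++ map (shiftArc m) θQ)) xs
    ≡⟨ cong₂ (λ i L → q ^ i * eλ L xs) (trans (asc-++ θP _) (cong (asc θP +_) (asc-shift m θQ)))
                                        (lam-blocks θP θQ upP upQ) ⟩
  q ^ (asc θP + asc θQ) * eλ (lam m θP ++ lam k θQ) xs
    ≡⟨ cong₂ _*_ (ℤ.^-distribˡ-+-* q (asc θP) (asc θQ)) (eλ-++ (lam m θP) (lam k θQ) xs) ⟩
  (q ^ asc θP * q ^ asc θQ) * (eλ (lam m θP) xs * eλ (lam k θQ) xs)
    ≡⟨ *-interchange (q ^ asc θP) (q ^ asc θQ) _ _ ⟩
  weight q xs m θP * weight q xs k θQ ∎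
  where open ≡-Reasoning

FΓ-blocks : ∀ {m k} E E′ → All (Upward m ∘ endpoints) E → All (Upward k ∘ endpoints) E′ → ∀ q xs →
            FΓ (m + k) (E ++ map (shiftEdge m) E′) q xs ≡ FΓ m E q xs * FΓ k E′ q xs
FΓ-blocks {m} {k} E E′ upE upE′ q xs = begin
  sumOrientations w (E ++ map (shiftEdge m) E′)
    ≡⟨ sumOrientations-++ w E _ ⟩
  sumOrientations (λ θ → sumOrientations (λ θ′ → w (θ ++ θ′)) (map (shiftEdge m) E′)) E
    ≡⟨ sumMap-cong (λ θ → sumOrientations-shift m (λ θ′ → w (θ ++ θ′)) E′) (orientationsOf E) ⟩
  sumOrientations (λ θ → sumOrientations (λ θ′ → w (θ ++ map (shiftArc m) θ′)) E′) E
    ≡⟨ sumMap-cong-local (All.map (λ {θ} upθ → sumMap-cong-local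
         (All.map (λ {θ′} upθ′ → weight-blocks q xs θ θ′ upθ upθ′) (orientations-upward E′ upE′)))
         (orientations-upward E upE)) ⟩
  sumOrientations (λ θ → sumOrientations (λ θ′ → weight q xs m θ * weight q xs k θ′) E′) E
    ≡⟨ sumMap-cong (λ θ → sumMap-*ˡ (weight q xs m θ) (weight q xs k) (orientationsOf E′))
                   (orientationsOf E) ⟩
  sumOrientations (λ θ → weight q xs m θ * FΓ k E′ q xs) E
    ≡⟨ sumMap-*ʳ (FΓ k E′ q xs) (weight q xs m) (orientationsOf E) ⟩
  FΓ m E q xs * FΓ k E′ q xs ∎
  where
  open ≡-Reasoning
  w = weight q xs (m + k)

FΓ-nonstrict : ∀ sz E {a b} → a < b → ∀ R q xs →
  FΓ sz (E ++ edge a b false ∷ R) q xs ≡ q * FΓ sz (E ++ edge a b true ∷ R) q xs ℤ.+ FΓ sz (E ++ R) q xs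
FΓ-nonstrict sz E {a} {b} a<b R q xs = begin
  sumOrientations w (E ++ edge a b false ∷ R)
    ≡⟨ sumOrientations-++ w E _ ⟩
  sumOrientations (λ θ → sumOrientations (λ θ′ → w (θ ++ θ′)) (edge a b false ∷ R)) E
    ≡⟨ sumMap-cong orient (orientationsOf E) ⟩
  sumOrientations (λ θ → q * withStrict θ ℤ.+ without θ) E
    ≡⟨ sumMap-+ (λ θ → q * withStrict θ) without (orientationsOf E) ⟩
  sumOrientations (λ θ → q * withStrict θ) E ℤ.+ sumOrientations without E
    ≡⟨ cong₂ ℤ._+_ (trans (sumMap-*ˡ q withStrict (orientationsOf E)) (cong (q *_) (sym strict)))
                   (sym (sumOrientations-++ w E R)) ⟩
  q * FΓ sz (E ++ edge a b true ∷ R) q xs ℤ.+ FΓ sz (E ++ R) q xs ∎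
  where
  open ≡-Reasoning
  w = weight q xs sz
  withStrict without : List Arc → ℤ
  withStrict θ = sumOrientations (λ θ′ → w (θ ++ arc a b true ∷ θ′)) R
  without    θ = sumOrientations (λ θ′ → w (θ ++ θ′)) R
  orient : ∀ θ →
    sumOrientations (λ θ′ → w (θ ++ θ′)) (edge a b false ∷ R) ≡ q * withStrict θ ℤ.+ without θ
  orient θ = begin
    sumOrientations (λ θ′ → w (θ ++ θ′)) (edge a b false ∷ R)
      ≡⟨ sumOrientations-∷ (λ θ′ → w (θ ++ θ′)) (edge a b false) R ⟩
    sumOrientations (λ θ′ → w (θ ++ arc a b false ∷ θ′)) R
      ℤ.+ (sumOrientations (λ θ′ → w (θ ++ arc b a false ∷ θ′)) R ℤ.+ ℤ.0ℤ)
      ≡⟨ cong₂ ℤ._+_ (trans (sumMap-cong (weight-ascending q xs sz θ a<b) (orientationsOf R))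
                            (sumMap-*ˡ q (λ θ′ → w (θ ++ arc a b true ∷ θ′)) (orientationsOf R)))
                     (trans (ℤ.+-identityʳ _) (sumMap-cong (weight-descending q xs sz θ a<b) (orientationsOf R))) ⟩
    q * withStrict θ ℤ.+ without θ ∎
  strict : FΓ sz (E ++ edge a b true ∷ R) q xs ≡ sumOrientations withStrict E
  strict = trans (sumOrientations-++ w E (edge a b true ∷ R))
    (sumMap-cong (λ θ → trans (sumOrientations-∷ (λ θ′ → w (θ ++ θ′)) (edge a b true) R) (ℤ.+-identityʳ _))
                 (orientationsOf E))

strictPathArcs : ℕ → ℕ → List Arc
strictPathArcs a zero    = []
strictPathArcs a (suc j) = arc a (suc a) true ∷ strictPathArcs (suc a) j

orientations-strictPath : ∀ a j → orientationsOf (strictPathEdges a j) ≡ strictPathArcs a j ∷ []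
orientations-strictPath a zero    = refl
orientations-strictPath a (suc j) = cong (map (arc a (suc a) true ∷_)) (orientations-strictPath (suc a) j)

asc-strictPath : ∀ a j → asc (strictPathArcs a j) ≡ 0
asc-strictPath a zero    = refl
asc-strictPath a (suc j) = asc-strictPath (suc a) j

strictPath-upward : ∀ {B} a j → 1 ≤ a → a + j ≤ B →
                    All (Upward B) (usableDigraph (strictPathArcs a j))
strictPath-upward a zero    _   _        = []
strictPath-upward {B} a (suc j) 1≤a a+1+j≤B =
  (1≤a , n<1+n a , ≤-trans (s≤s (m≤m+n a j)) 1+a+j≤B)
    ∷ strictPath-upward (suc a) j (m≤n⇒m≤1+n 1≤a) 1+a+j≤B
  where 1+a+j≤B = subst (_≤ B) (+-suc a j) a+1+j≤B

strictPath-∈ : ∀ a j {u} → a ≤ u → u < a + j → (u , suc u) ∈ usableDigraph (strictPathArcs a j)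
strictPath-∈ a zero    {u} a≤u u<a+0 = ⊥-elim (<⇒≱ u<a+0 (subst (_≤ u) (sym (+-identityʳ a)) a≤u))
strictPath-∈ a (suc j) {u} a≤u u<a+1+j with m≤n⇒m<n∨m≡n a≤u
... | inj₂ refl = here refl
... | inj₁ a<u  = there (strictPath-∈ (suc a) j a<u (subst (u <_) (+-suc a j) u<a+1+j))

hrv-strictPath : ∀ k {u} → IsVertex (suc k) u → hrv (suc k) (strictPathArcs 1 k) u ≡ suc k
hrv-strictPath k {u} u∈ = ≤-antisym (proj₂ (hrv-IsVertex {θ = strictPathArcs 1 k} up u∈))
  (subst (suc k ≤_) (sym (hrv≡ (suc k) (strictPathArcs 1 k) u))
         (climb (suc k) (proj₁ u∈) (m≤n+m (suc k) u)))
  where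
  G = usableDigraph (strictPathArcs 1 k)
  up : All (Upward (suc k)) G
  up = strictPath-upward 1 k ≤-refl ≤-refl
  climb : ∀ f {v} → 1 ≤ v → suc k ≤ v + f → suc k ≤ maxℕ (reachable G f v)
  climb zero    {v} _   top = ≤-trans (subst (suc k ≤_) (+-identityʳ v) top) (maxℕ-reachable-≥ G 0 v)
  climb (suc f) {v} 1≤v top with suc k ≤? v
  ... | yes k<v = ≤-trans k<v (maxℕ-reachable-≥ G (suc f) v)
  ... | no  k≮v = ≤-trans (climb f (m≤n⇒m≤1+n 1≤v) (subst (suc k ≤_) (+-suc v f) top))
                          (maxℕ-reachable-step (strictPath-∈ 1 k 1≤v (≰⇒> k≮v)))

FΓ-strictPath : ∀ k q xs → FΓ (suc k) (strictPathEdges 1 k) q xs ≡ eSym (suc k) xs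
FΓ-strictPath k q xs = begin
  sumOrientations (weight q xs (suc k)) (strictPathEdges 1 k)
    ≡⟨ cong (sumMap (weight q xs (suc k))) (orientations-strictPath 1 k) ⟩
  weight q xs (suc k) θ ℤ.+ ℤ.0ℤ
    ≡⟨ ℤ.+-identityʳ _ ⟩
  q ^ asc θ * eλ (lam (suc k) θ) xs
    ≡⟨ cong₂ (λ i L → q ^ i * eλ L xs) (asc-strictPath 1 k)
                                        (classSizes-const k (hrv (suc k) θ) (hrv-strictPath k)) ⟩
  ℤ.1ℤ * (eSym (suc k) xs * ℤ.1ℤ)
    ≡⟨ trans (ℤ.*-identityˡ _) (ℤ.*-identityʳ _) ⟩
  eSym (suc k) xs ∎
  where
  open ≡-Reasoning
  θ = strictPathArcs 1 k

F-n-dᵏ-e : ∀ k q xs → F (n ∷ replicate k d ++ e ∷ []) q xs ≡ eSym (suc k) xs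
F-n-dᵏ-e k q xs =
  trans (cong₂ (λ sz E → FΓ sz E q xs) (size-dʲe k) (edges-n-dᵏ-e k)) (FΓ-strictPath k q xs)

F-++ : ∀ P Q → IsSchroder P → IsSchroder Q → ∀ q xs → F (P ++ Q) q xs ≡ F P q xs * F Q q xs
F-++ P Q isP isQ q xs = trans (cong₂ (λ sz E → FΓ sz E q xs) (size-++ P Q) (edges-++ isP isQ))
                              (FΓ-blocks (edges P) (edges Q) (edges-upward P) (edges-upward Q) q xs)

F-ne-en : ∀ U V → IsSchroder (U ++ d ∷ V) → ∀ q xs →
          F (U ++ n ∷ e ∷ V) q xs - F (U ++ e ∷ n ∷ V) q xs ≡ q * F (U ++ d ∷ V) q xs
F-ne-en U V isS q xs = begin
  F (U ++ n ∷ e ∷ V) q xs - F (U ++ e ∷ n ∷ V) q xs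
    ≡⟨ cong₂ _-_ (cong₂ FΓ′ (size-++-congʳ U (n ∷ e ∷ V) (d ∷ V) (sym (size-d∷ V))) edges₁)
                 (cong₂ FΓ′ (size-++-congʳ U (e ∷ n ∷ V) (d ∷ V) (sym (size-d∷ V))) edges₀) ⟩
  FΓ′ sz (E ++ edge a b false ∷ R) - FΓ′ sz (E ++ R)
    ≡⟨ cong (_- FΓ′ sz (E ++ R)) (FΓ-nonstrict sz E a<b R q xs) ⟩
  (q * FΓ′ sz (E ++ edge a b true ∷ R) ℤ.+ FΓ′ sz (E ++ R)) - FΓ′ sz (E ++ R)
    ≡⟨ +-minus-cancelʳ (FΓ′ sz (E ++ R)) _ ⟩
  q * FΓ′ sz (E ++ edge a b true ∷ R)
    ≡⟨ cong (λ E′ → q * FΓ′ sz E′) (sym edges₂) ⟩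
  q * F (U ++ d ∷ V) q xs ∎
  where
  open ≡-Reasoning
  open DifferInOneEdge (en-ne-d-differInOneEdge U V isS)
  sz = size (U ++ d ∷ V)
  FΓ′ : ℕ → List Edge → ℤ
  FΓ′ s E′ = FΓ s E′ q xs

proposition5p2 :
    (∀ (k : ℕ) (q : ℤ) (xs : List ℤ) →
       F (n ∷ (replicate k d ++ (e ∷ []))) q xs ≡ eSym (suc k) xs)
    × (∀ (P Q : List Step) → IsSchroder P → IsSchroder Q →
       ∀ (q : ℤ) (xs : List ℤ) → F (P ++ Q) q xs ≡ F P q xs * F Q q xs)
    × (∀ (U V : List Step) → IsSchroder (U ++ (d ∷ V)) →
       ∀ (q : ℤ) (xs : List ℤ) →
       F (U ++ (n ∷ e ∷ V)) q xs - F (U ++ (e ∷ n ∷ V)) q xs ≡ q * F (U ++ (d ∷ V)) q xs)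
proposition5p2 = F-n-dᵏ-e , F-++ , F-ne-en
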